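{- Let $G$ be a tree with vertex set $\{w_1,\dots,w_n\}$. Then the graph $G\bowtie G$ is a bipartite planar graph with exactly $2(2n-2)$ edges.
   Context: For a simple graph $G$ with vertex set $\{w_1,w_2,\dots,w_n\}$, the graph $G\bowtie G$ has vertex set $\{u_1,\dots,u_n,v_1,\dots,v_n\}$ (two copies of $V(G)$), and for symbols $x,y\in\{u,v\}$ and indices $i,j$, the vertices $x_i$ and $y_j$ are adjacent if and only if $w_iw_j$ is an edge of $G$. Thus each edge $w_iw_j$ of $G$ produces the four edges $u_iu_j$, $v_iv_j$, $u_iv_j$, $v_iu_j$. -}

module Defs where

open import Data.Nat using (ℕ; zero; suc; _+_; _*_; _∸_; _≤_; _<ᵇ_)
open import Data.Bool using (Bool; true; false; if_then_else_; _∧_)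
open import Data.Fin using (Fin; toℕ; splitAt; inject₁; fromℕ) renaming (zero to fzero; suc to fsuc)
open import Data.List using (List; map; allFin)
open import Data.Nat.ListAction using (sum)
open import Data.Sum using (_⊎_; inj₁; inj₂; [_,_])
open import Data.Product using (Σ; _×_; _,_)
open import Data.Rational using (ℚ; 0ℚ; 1ℚ) renaming (_+_ to _+ℚ_; _-_ to _-ℚ_; _*_ to _*ℚ_; _≤_ to _≤ℚ_)
open import Function using (id; _∘_)
open import Function.Definitions using (Injective)
open import Relation.Binary.PropositionalEquality using (_≡_; _≢_)
open import Relation.Nullary using (¬_)

record SimpleGraph (n : ℕ) : Set where
  field
    Adj    : Fin n → Fin n → Bool
    sym    : ∀ x y → Adj x y ≡ Adj y x
    irrefl : ∀ x → Adj x x ≡ false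
open SimpleGraph public

edgeCount : ∀ {n} → SimpleGraph n → ℕ
edgeCount {n} G =
  sum (map (λ i → sum (map (λ j → if (toℕ i <ᵇ toℕ j) ∧ Adj G i j then 1 else 0)
                          (allFin n)))
           (allFin n))

data Walk {n} (G : SimpleGraph n) : Fin n → Fin n → Set where
  nil  : ∀ {x} → Walk G x x
  cons : ∀ {x y z} → Adj G x z ≡ true → Walk G z y → Walk G x y

Connected : ∀ {n} → SimpleGraph n → Set
Connected {n} G = (x y : Fin n) → Walk G x y

-- a cycle of length 3 + k: distinct vertices c 0, ..., c (2+k), consecutive ones
-- adjacent and the last adjacent to the first
record Cycle {n} (G : SimpleGraph n) : Set where
  field
    k     : ℕ
    c     : Fin (3 + k) → Fin n
    inj   : Injective _≡_ _≡_ c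
    step  : ∀ (i : Fin (2 + k)) → Adj G (c (inject₁ i)) (c (fsuc i)) ≡ true
    close : Adj G (c (fromℕ (2 + k))) (c fzero) ≡ true

Acyclic : ∀ {n} → SimpleGraph n → Set
Acyclic G = ¬ Cycle G

IsTree : ∀ {n} → SimpleGraph n → Set
IsTree {n} G = (1 ≤ n) × Connected G × Acyclic G

-- G ⋈ G on Fin (n + n): x ∈ Fin (n + n) is u_i if splitAt n x = inj₁ i,
-- and v_i if splitAt n x = inj₂ i.  x_i ~ y_j iff w_i ~ w_j in G.
strip : ∀ {n} → Fin (n + n) → Fin n
strip {n} x = [ id , id ] (splitAt n x)

bowtie : ∀ {n} → SimpleGraph n → SimpleGraph (n + n)
bowtie G = record
  { Adj    = λ x y → Adj G (strip x) (strip y)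
  ; sym    = λ x y → sym G (strip x) (strip y)
  ; irrefl = λ x → irrefl G (strip x)
  }

Bipartite : ∀ {n} → SimpleGraph n → Set
Bipartite {n} G = Σ (Fin n → Bool) λ col → ∀ x y → Adj G x y ≡ true → col x ≢ col y

-- planarity via straight-line drawings with rational coordinates
Point : Set
Point = ℚ × ℚ

segPt : ℚ → Point → Point → Point
segPt s (a₁ , a₂) (b₁ , b₂) = (a₁ +ℚ s *ℚ (b₁ -ℚ a₁)) , (a₂ +ℚ s *ℚ (b₂ -ℚ a₂))

InUnit : ℚ → Set
InUnit s = (0ℚ ≤ℚ s) × (s ≤ℚ 1ℚ)

SameEdge : ∀ {n} → Fin n → Fin n → Fin n → Fin n → Set
SameEdge a b c d = ((a ≡ c) × (b ≡ d)) ⊎ ((a ≡ d) × (b ≡ c))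

record PlaneDrawing {n} (G : SimpleGraph n) : Set where
  field
    pos      : Fin n → Point
    pos-inj  : Injective _≡_ _≡_ pos
    vert-off : ∀ w a b → Adj G a b ≡ true → ∀ s → InUnit s →
               pos w ≡ segPt s (pos a) (pos b) → (w ≡ a) ⊎ (w ≡ b)
    edges-ok : ∀ a b c d → Adj G a b ≡ true → Adj G c d ≡ true → ¬ SameEdge a b c d →
               ∀ s t → InUnit s → InUnit t →
               segPt s (pos a) (pos b) ≡ segPt t (pos c) (pos d) →
               Σ (Fin n) λ w → ((w ≡ a) ⊎ (w ≡ b)) × ((w ≡ c) ⊎ (w ≡ d))
                              × (pos w ≡ segPt s (pos a) (pos b))

Planar : ∀ {n} → SimpleGraph n → Set
Planar G = PlaneDrawing G

module Submission where

-- Root the tree by breadth-first search.  In a tree every edge joins a vertex to its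
-- parent: otherwise the paths from its ends up to their first common ancestor, closed
-- by the edge or by a second parent, would form a cycle.  Sending both copies of w to
-- (root path of w , copy) therefore makes G ⋈ G a subgraph of the doubled infinite
-- tree, in which (L , t) is joined to (L ∷ʳ c , t′) for all c, t, t′.  That graph is
-- bipartite by the parity of the length of L, and it has a self-similar straight-line
-- drawing: the copies of the root are the poles (0 , ±1), the copies of its child c
-- are (3c + 1 , 0) and (3c + 3 , 0), and everything below c is an affine image of the
-- whole drawing squeezed into a thin triangle standing on [3c + 1 , 3c + 3], too thin
-- to meet any segment from the poles.  For the count, a tree has 2(n - 1) ordered
-- pairs (x , parent x) and (parent x , x), and each edge of G gives four edges of G ⋈ G.

open import Defs hiding (sym)
open import Data.Nat.Base using (ℕ)
open import Data.Fin.Base using (Fin; fromℕ<)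
open import Data.Bool.Base using (true)
open import Data.List.Base using (List; []; _∷ʳ_)
open import Data.Product.Base using (_×_; _,_)
open import Data.Sum.Base using (_⊎_)
open import Relation.Binary.PropositionalEquality using (_≡_; _≢_)

module Snoc {A : Set} where

  open import Data.List.Base using (_∷_; length)
  open import Data.Nat.Base using (suc)
  open import Relation.Binary.PropositionalEquality using (refl; cong)

  length-∷ʳ : ∀ (xs : List A) x → length (xs ∷ʳ x) ≡ suc (length xs)
  length-∷ʳ []       x = refl
  length-∷ʳ (_ ∷ xs) x = cong suc (length-∷ʳ xs x)

  ∷ʳ≢[] : ∀ (xs : List A) x → xs ∷ʳ x ≢ []
  ∷ʳ≢[] []      x ()
  ∷ʳ≢[] (_ ∷ _) x ()

module LeastNumber where

  open import Data.Empty using (⊥-elim)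
  open import Data.Nat.Base using (zero; suc; _<_; s≤s⁻¹)
  open import Data.Product.Base using (Σ)
  open import Function.Base using (_∘_)
  open import Relation.Nullary.Decidable.Core using (Dec; yes; no)
  open import Relation.Nullary.Negation.Core using (¬_)

  least : ∀ {P : ℕ → Set} → (∀ i → Dec (P i)) → ∀ k → P k → Σ ℕ λ i → P i × (∀ j → j < i → ¬ P j)
  least P? k Pk with P? 0
  ... | yes P0 = 0 , P0 , λ _ ()
  least P? zero    Pk | no ¬P0 = ⊥-elim (¬P0 Pk)
  least P? (suc k) Pk | no ¬P0 with least (P? ∘ suc) k Pk
  ... | i , Pi , below = suc i , Pi , λ { zero _ → ¬P0 ; (suc j) j<i → below j (s≤s⁻¹ j<i) }

module RationalOrder where

  open import Data.Empty using (⊥-elim)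
  open import Data.Nat.Base as ℕ using (zero; suc; z≤n; s≤s)
  open import Data.Nat.Properties as ℕ using (_≤?_; ≰⇒>)
  open import Data.Rational.Base
  open import Data.Rational.Properties
  open import Data.Sum.Base using (inj₁; inj₂)
  open import Relation.Binary.Definitions using (tri<; tri≈; tri>)
  open import Relation.Binary.PropositionalEquality
  open import Relation.Nullary.Decidable.Core using (yes; no; dec⇒maybe)
  open import Tactic.RingSolver using (solve-∀)
  open import Tactic.RingSolver.Core.AlmostCommutativeRing using (AlmostCommutativeRing; fromCommutativeRing)

  ℚ-ring : AlmostCommutativeRing _ _
  ℚ-ring = fromCommutativeRing +-*-commutativeRing (λ x → dec⇒maybe (0ℚ ≟ x))

  ≤⇒0≤- : ∀ {p q} → p ≤ q → 0ℚ ≤ q - p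
  ≤⇒0≤- {p} {q} p≤q = subst (_≤ q - p) (+-inverseʳ p) (+-monoˡ-≤ (- p) p≤q)

  0≤-⇒≤ : ∀ {p q} → 0ℚ ≤ q - p → p ≤ q
  0≤-⇒≤ {p} {q} 0≤q-p = subst₂ _≤_ (+-identityˡ p) (q-p+p≡q p q) (+-monoˡ-≤ p 0≤q-p)
    where
    q-p+p≡q : ∀ p q → (q - p) + p ≡ q
    q-p+p≡q = solve-∀ ℚ-ring

  1-s-nonNeg : ∀ {s} → InUnit s → 0ℚ ≤ 1ℚ - s
  1-s-nonNeg (_ , s≤1) = ≤⇒0≤- s≤1

  p-[p-q]≡q : ∀ p q → p - (p - q) ≡ q
  p-[p-q]≡q = solve-∀ ℚ-ring

  -‿cancelˡ : ∀ p q r → p - q ≡ p - r → q ≡ r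
  -‿cancelˡ p q r eq = trans (sym (p-[p-q]≡q p q)) (trans (cong (λ u → p - u) eq) (p-[p-q]≡q p r))

  1-s≡0⇒s≡1 : ∀ {s} → 1ℚ - s ≡ 0ℚ → s ≡ 1ℚ
  1-s≡0⇒s≡1 {s} 1-s≡0 = trans (sym (p-[p-q]≡q 1ℚ s)) (cong (λ u → 1ℚ - u) 1-s≡0)

  nonNeg+nonNeg : ∀ {p q} → 0ℚ ≤ p → 0ℚ ≤ q → 0ℚ ≤ p + q
  nonNeg+nonNeg 0≤p 0≤q = +-mono-≤ 0≤p 0≤q

  pos+nonNeg : ∀ {p q} → 0ℚ < p → 0ℚ ≤ q → 0ℚ < p + q
  pos+nonNeg 0<p 0≤q = +-mono-<-≤ 0<p 0≤q

  nonNeg*nonNeg : ∀ {p q} → 0ℚ ≤ p → 0ℚ ≤ q → 0ℚ ≤ p * q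
  nonNeg*nonNeg {p} {q} 0≤p 0≤q =
    nonNegative⁻¹ (p * q) {{nonNeg*nonNeg⇒nonNeg p {{nonNegative 0≤p}} q {{nonNegative 0≤q}}}}

  pos*pos : ∀ {p q} → 0ℚ < p → 0ℚ < q → 0ℚ < p * q
  pos*pos {p} {q} 0<p 0<q = positive⁻¹ (p * q) {{pos*pos⇒pos p {{positive 0<p}} q {{positive 0<q}}}}

  nonNeg-cancelˡ : ∀ {p q} → 0ℚ < p → 0ℚ ≤ p * q → 0ℚ ≤ q
  nonNeg-cancelˡ {p} {q} 0<p 0≤pq = *-cancelˡ-≤-pos p {{positive 0<p}} (subst (_≤ p * q) (sym (*-zeroʳ p)) 0≤pq)

  *-cancelˡ-pos : ∀ {p q r} → 0ℚ < p → p * q ≡ p * r → q ≡ r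
  *-cancelˡ-pos {p} 0<p pq≡pr = ≤-antisym
    (*-cancelˡ-≤-pos p {{positive 0<p}} (≤-reflexive pq≡pr))
    (*-cancelˡ-≤-pos p {{positive 0<p}} (≤-reflexive (sym pq≡pr)))

  zero-cancelˡ : ∀ {p q} → 0ℚ < p → p * q ≡ 0ℚ → q ≡ 0ℚ
  zero-cancelˡ {p} 0<p pq≡0 = *-cancelˡ-pos 0<p (trans pq≡0 (sym (*-zeroʳ p)))

  nonNeg⇒≡0⊎pos : ∀ {p} → 0ℚ ≤ p → p ≡ 0ℚ ⊎ 0ℚ < p
  nonNeg⇒≡0⊎pos {p} 0≤p with <-cmp 0ℚ p
  ... | tri< 0<p _ _ = inj₂ 0<p
  ... | tri≈ _ 0≡p _ = inj₁ (sym 0≡p)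
  ... | tri> _ _ p<0 = ⊥-elim (<-irrefl refl (<-≤-trans p<0 0≤p))

  nonNeg+nonNeg≡0 : ∀ {p q} → 0ℚ ≤ p → 0ℚ ≤ q → p + q ≡ 0ℚ → p ≡ 0ℚ × q ≡ 0ℚ
  nonNeg+nonNeg≡0 {p} {q} 0≤p 0≤q p+q≡0 = p≡0 , trans (sym (+-identityˡ q)) (trans (cong (_+ q) (sym p≡0)) p+q≡0)
    where
    p≡0 : p ≡ 0ℚ
    p≡0 = ≤-antisym (subst₂ _≤_ (+-identityʳ p) p+q≡0 (+-monoʳ-≤ p 0≤q)) 0≤p

  ι : ℕ → ℚ
  ι zero    = 0ℚ
  ι (suc k) = 1ℚ + ι k

  ι-mono-≤ : ∀ {k l} → k ℕ.≤ l → ι k ≤ ι l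
  ι-mono-≤ {l = zero}  z≤n      = ≤-refl
  ι-mono-≤ {l = suc l} z≤n      = nonNeg+nonNeg (nonNegative⁻¹ 1ℚ) (ι-mono-≤ {l = l} z≤n)
  ι-mono-≤               (s≤s k≤l) = +-monoʳ-≤ 1ℚ (ι-mono-≤ k≤l)

  ι-nonNeg : ∀ k → 0ℚ ≤ ι k
  ι-nonNeg k = ι-mono-≤ {zero} {k} z≤n

  ι-cancel-≤ : ∀ {k l} → ι k ≤ ι l → k ℕ.≤ l
  ι-cancel-≤ {k} {l} ιk≤ιl with k ℕ.≤? l
  ... | yes k≤l = k≤l
  ... | no  k≰l = ⊥-elim (<-irrefl refl (<-≤-trans ιl<1+ιl (≤-trans (ι-mono-≤ (ℕ.≰⇒> k≰l)) ιk≤ιl)))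
    where
    ιl<1+ιl : ι l < 1ℚ + ι l
    ιl<1+ιl = subst (_< 1ℚ + ι l) (+-identityˡ (ι l)) (+-monoˡ-< (ι l) (positive⁻¹ 1ℚ))

module Segment where

  open import Data.Rational.Base
  open import Relation.Binary.PropositionalEquality
  open import Tactic.RingSolver using (solve-∀)
  open RationalOrder using (ℚ-ring; 1-s-nonNeg; 0≤-⇒≤; p-[p-q]≡q)

  segPt-0 : ∀ A C → segPt 0ℚ A C ≡ A
  segPt-0 (a₁ , a₂) (c₁ , c₂) = cong₂ _,_ (a+0[c-a]≡a a₁ c₁) (a+0[c-a]≡a a₂ c₂)
    where
    a+0[c-a]≡a : ∀ a c → a + 0ℚ * (c - a) ≡ a
    a+0[c-a]≡a = solve-∀ ℚ-ring

  segPt-1 : ∀ A C → segPt 1ℚ A C ≡ C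
  segPt-1 (a₁ , a₂) (c₁ , c₂) = cong₂ _,_ (a+1[c-a]≡c a₁ c₁) (a+1[c-a]≡c a₂ c₂)
    where
    a+1[c-a]≡c : ∀ a c → a + 1ℚ * (c - a) ≡ c
    a+1[c-a]≡c = solve-∀ ℚ-ring

  segPt-swap : ∀ s A C → segPt s A C ≡ segPt (1ℚ - s) C A
  segPt-swap s (a₁ , a₂) (c₁ , c₂) = cong₂ _,_ (swap a₁ c₁ s) (swap a₂ c₂ s)
    where
    swap : ∀ a c s → a + s * (c - a) ≡ c + (1ℚ - s) * (a - c)
    swap = solve-∀ ℚ-ring

  InUnit-swap : ∀ {s} → InUnit s → InUnit (1ℚ - s)
  InUnit-swap {s} s∈I@(0≤s , _) = 1-s-nonNeg s∈I , 0≤-⇒≤ (subst (0ℚ ≤_) (sym (p-[p-q]≡q 1ℚ s)) 0≤s)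

module Fan (N : ℕ) where

  open import Data.Bool.Base using (Bool; false)
  open import Data.Fin.Base using (toℕ)
  import Data.Fin.Properties as Fin
  import Data.Nat.Base as ℕ
  import Data.Nat.Properties as ℕ
  open import Data.Product.Base using (proj₁; proj₂)
  open import Data.Rational.Base
  open import Data.Rational.Properties
  open import Data.Sum.Base using (inj₁; inj₂)
  open import Relation.Binary.PropositionalEquality
  open import Tactic.RingSolver using (solve-∀)
  open RationalOrder
  open Segment using (segPt-0; segPt-1)

  -- Opaque, so that type checking never unfolds the rational arithmetic of the drawing.
  opaque
    B : ℚ
    B = 1ℚ + ι (3 ℕ.* N)

    0<B : 0ℚ < B
    0<B = pos+nonNeg (positive⁻¹ 1ℚ) (ι-nonNeg (3 ℕ.* N))

    0<B*B : 0ℚ < B * B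
    0<B*B = pos*pos 0<B 0<B

    ε : ℚ
    ε = (1/ (B * B)) {{pos⇒nonZero (B * B) {{positive 0<B*B}}}}

    sign : Bool → ℚ
    sign true  = 1ℚ
    sign false = - 1ℚ

    hub : Fin N → ℚ
    hub c = ι (2 ℕ.+ 3 ℕ.* toℕ c)

    pole : Bool → Point
    pole t = 0ℚ , sign t

    -- maps the triangle with corners (0 , ±1), (B , 0) onto the thin triangle
    -- with corners (hub c ∓ 1 , 0), (hub c , ε B)
    shrink : Fin N → Point → Point
    shrink c (x , y) = hub c - y , ε * x

    foot : Fin N → Bool → ℚ
    foot c t = hub c - sign t

    fan : Bool → Fin N → Bool → ℚ → Point
    fan t c t′ s = segPt s (pole t) (shrink c (pole t′))

  record Within1 (y : ℚ) : Set where
    constructor within1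
    field
      upper : 0ℚ ≤ 1ℚ - y
      lower : 0ℚ ≤ 1ℚ + y

  record Triangle (p : Point) : Set where
    constructor triangle
    field
      right-of-axis    : 0ℚ ≤ proj₁ p
      below-upper-side : 0ℚ ≤ B - (proj₁ p + B * proj₂ p)
      above-lower-side : 0ℚ ≤ B - (proj₁ p - B * proj₂ p)

  record Slot (c : Fin N) (x : ℚ) : Set where
    constructor slot
    field
      after-start : 0ℚ ≤ x - (hub c - 1ℚ)
      before-end  : 0ℚ ≤ (hub c + 1ℚ) - x

  data FanMeeting (t : Bool) (c : Fin N) (t′ u : Bool) (d : Fin N) (u′ : Bool) (s : ℚ) : Set where
    same-fan : t ≡ u → c ≡ d → t′ ≡ u′ → FanMeeting t c t′ u d u′ s
    at-pole  : t ≡ u → fan t c t′ s ≡ pole t → FanMeeting t c t′ u d u′ s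
    at-foot  : c ≡ d → t′ ≡ u′ → fan t c t′ s ≡ shrink c (pole t′) → FanMeeting t c t′ u d u′ s

  opaque
    unfolding B ε sign hub pole shrink foot fan

    0<ε : 0ℚ < ε
    0<ε = positive⁻¹ ε {{1/pos⇒pos (B * B) {{positive 0<B*B}}}}

    0≤ε : 0ℚ ≤ ε
    0≤ε = <⇒≤ 0<ε

    0≤B : 0ℚ ≤ B
    0≤B = <⇒≤ 0<B

    0≤1-εBB : 0ℚ ≤ 1ℚ - ε * (B * B)
    0≤1-εBB = ≤-reflexive (sym (trans (cong (λ u → 1ℚ - u) εBB≡1) (+-inverseʳ 1ℚ)))
      where
      εBB≡1 : ε * (B * B) ≡ 1ℚ
      εBB≡1 = *-inverseˡ (B * B) {{pos⇒nonZero (B * B) {{positive 0<B*B}}}}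

    sign-within1 : ∀ t → Within1 (sign t)
    sign-within1 true  = within1 (nonNegative⁻¹ _) (nonNegative⁻¹ _)
    sign-within1 false = within1 (nonNegative⁻¹ _) (nonNegative⁻¹ _)

    sign-injective : ∀ {t u} → sign t ≡ sign u → t ≡ u
    sign-injective {true}  {true}  _ = refl
    sign-injective {false} {false} _ = refl
    sign-injective {true}  {false} ()
    sign-injective {false} {true}  ()

    pole-injective : ∀ v t → pole v ≡ pole t → v ≡ t
    pole-injective v t eq = sign-injective (cong proj₂ eq)

    3a≤2+3b⇒a≤b : ∀ a b → 3 ℕ.* a ℕ.≤ 2 ℕ.+ 3 ℕ.* b → a ℕ.≤ b
    3a≤2+3b⇒a≤b a b 3a≤2+3b =
      ℕ.s≤s⁻¹ (ℕ.*-cancelˡ-< 3 a (ℕ.suc b) (subst (3 ℕ.* a ℕ.<_) (sym (ℕ.*-suc 3 b)) (ℕ.s≤s 3a≤2+3b)))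

    slot-≤ : ∀ {a b x} → Slot a x → Slot b x → toℕ a ℕ.≤ toℕ b
    slot-≤ {a} {b} {x} (slot above-a _) (slot _ below-b) = 3a≤2+3b⇒a≤b (toℕ a) (toℕ b)
      (ℕ.s≤s⁻¹ (ℕ.s≤s⁻¹ (ι-cancel-≤ {2 ℕ.+ 3 ℕ.* toℕ a} {4 ℕ.+ 3 ℕ.* toℕ b} (0≤-⇒≤ 0≤gap))))
      where
      gap : ∀ h h′ x → (x - (h - 1ℚ)) + ((h′ + 1ℚ) - x) ≡ (1ℚ + (1ℚ + h′)) - h
      gap = solve-∀ ℚ-ring
      0≤gap : 0ℚ ≤ (1ℚ + (1ℚ + hub b)) - hub a
      0≤gap = subst (0ℚ ≤_) (gap (hub a) (hub b) x) (nonNeg+nonNeg above-a below-b)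

    slot-unique : ∀ {a b x} → Slot a x → Slot b x → a ≡ b
    slot-unique a∋x b∋x = Fin.toℕ-injective (ℕ.≤-antisym (slot-≤ a∋x b∋x) (slot-≤ b∋x a∋x))

    slot-around-hub : ∀ c {y} → Within1 y → Slot c (hub c - y)
    slot-around-hub c {y} (within1 0≤1-y 0≤1+y) =
      slot (subst (0ℚ ≤_) (sym (lower (hub c) y)) 0≤1-y) (subst (0ℚ ≤_) (sym (upper (hub c) y)) 0≤1+y)
      where
      lower : ∀ h y → (h - y) - (h - 1ℚ) ≡ 1ℚ - y
      lower = solve-∀ ℚ-ring
      upper : ∀ h y → (h + 1ℚ) - (h - y) ≡ 1ℚ + y
      upper = solve-∀ ℚ-ring

    foot∈slot : ∀ c t → Slot c (foot c t)
    foot∈slot c t = slot-around-hub c (sign-within1 t)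

    0<hub-1 : ∀ c → 0ℚ < hub c - 1ℚ
    0<hub-1 c = subst (0ℚ <_) (sym (drop-1 (ι (3 ℕ.* toℕ c)))) (pos+nonNeg (positive⁻¹ 1ℚ) (ι-nonNeg (3 ℕ.* toℕ c)))
      where
      drop-1 : ∀ z → (1ℚ + (1ℚ + z)) - 1ℚ ≡ 1ℚ + z
      drop-1 = solve-∀ ℚ-ring

    0<B-[hub+1] : ∀ c → 0ℚ < B - (hub c + 1ℚ)
    0<B-[hub+1] c = subst (0ℚ <_) (sym (rearrange (ι (3 ℕ.* N)) (hub c)))
      (pos+nonNeg (positive⁻¹ 1ℚ) (≤⇒0≤- (ι-mono-≤ 3+3c≤3N)))
      where
      rearrange : ∀ u h → (1ℚ + u) - (h + 1ℚ) ≡ 1ℚ + (u - (1ℚ + h))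
      rearrange = solve-∀ ℚ-ring
      3+3c≤3N : 3 ℕ.+ 3 ℕ.* toℕ c ℕ.≤ 3 ℕ.* N
      3+3c≤3N = subst (ℕ._≤ 3 ℕ.* N) (ℕ.*-suc 3 (toℕ c)) (ℕ.*-monoʳ-≤ 3 (Fin.toℕ<n c))

    slot-pos : ∀ {c x} → Slot c x → 0ℚ < x
    slot-pos {c} {x} (slot above _) = subst (0ℚ <_) (split (hub c) x) (pos+nonNeg (0<hub-1 c) above)
      where
      split : ∀ h x → (h - 1ℚ) + (x - (h - 1ℚ)) ≡ x
      split = solve-∀ ℚ-ring

    slot-<B : ∀ {c x} → Slot c x → 0ℚ < B - x
    slot-<B {c} {x} (slot _ below) = subst (0ℚ <_) (split B (hub c) x) (pos+nonNeg (0<B-[hub+1] c) below)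
      where
      split : ∀ b h x → (b - (h + 1ℚ)) + ((h + 1ℚ) - x) ≡ b - x
      split = solve-∀ ℚ-ring

    within1-triangle : ∀ {x y} → Triangle (x , y) → Within1 y
    within1-triangle {x} {y} (triangle 0≤x 0≤l 0≤r) = within1
      (nonNeg-cancelˡ 0<B (subst (0ℚ ≤_) (lower B x y) (nonNeg+nonNeg 0≤l 0≤x)))
      (nonNeg-cancelˡ 0<B (subst (0ℚ ≤_) (upper B x y) (nonNeg+nonNeg 0≤r 0≤x)))
      where
      lower : ∀ b x y → (b - (x + b * y)) + x ≡ b * (1ℚ - y)
      lower = solve-∀ ℚ-ring
      upper : ∀ b x y → (b - (x - b * y)) + x ≡ b * (1ℚ + y)
      upper = solve-∀ ℚ-ring

    triangle-pole : ∀ t → Triangle (pole t)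
    triangle-pole t = triangle ≤-refl
      (subst (0ℚ ≤_) (lower B (sign t)) (nonNeg*nonNeg 0≤B (Within1.upper (sign-within1 t))))
      (subst (0ℚ ≤_) (upper B (sign t)) (nonNeg*nonNeg 0≤B (Within1.lower (sign-within1 t))))
      where
      lower : ∀ b σ → b * (1ℚ - σ) ≡ b - (0ℚ + b * σ)
      lower = solve-∀ ℚ-ring
      upper : ∀ b σ → b * (1ℚ + σ) ≡ b - (0ℚ - b * σ)
      upper = solve-∀ ℚ-ring

    triangle-shrink : ∀ c {p} → Triangle p → Triangle (shrink c p)
    triangle-shrink c {x , y} p∈T@(triangle 0≤x _ 0≤r) = triangle
      (subst (0ℚ ≤_) (left (hub c) y) (nonNeg+nonNeg (<⇒≤ (0<hub-1 c)) (Within1.upper y∈I)))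
      (subst (0ℚ ≤_) (lower B ε (hub c) x y)
        (nonNeg+nonNeg (nonNeg+nonNeg room (nonNeg*nonNeg 0≤1-εBB (Within1.lower y∈I))) (nonNeg*nonNeg 0≤εB 0≤r)))
      (subst (0ℚ ≤_) (upper B ε (hub c) x y)
        (nonNeg+nonNeg (nonNeg+nonNeg room (Within1.lower y∈I)) (nonNeg*nonNeg 0≤B (nonNeg*nonNeg 0≤ε 0≤x))))
      where
      y∈I : Within1 y
      y∈I = within1-triangle p∈T
      room : 0ℚ ≤ B - (hub c + 1ℚ)
      room = <⇒≤ (0<B-[hub+1] c)
      0≤εB : 0ℚ ≤ ε * B
      0≤εB = nonNeg*nonNeg 0≤ε 0≤B
      left : ∀ h y → (h - 1ℚ) + (1ℚ - y) ≡ h - y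
      left = solve-∀ ℚ-ring
      lower : ∀ b e h x y →
        ((b - (h + 1ℚ)) + (1ℚ - e * (b * b)) * (1ℚ + y)) + (e * b) * (b - (x - b * y)) ≡ b - ((h - y) + b * (e * x))
      lower = solve-∀ ℚ-ring
      upper : ∀ b e h x y → ((b - (h + 1ℚ)) + (1ℚ + y)) + b * (e * x) ≡ b - ((h - y) - b * (e * x))
      upper = solve-∀ ℚ-ring

    shrink-injective : ∀ c p q → shrink c p ≡ shrink c q → p ≡ q
    shrink-injective c (x , y) (x′ , y′) eq =
      cong₂ _,_ (*-cancelˡ-pos 0<ε (cong proj₂ eq)) (-‿cancelˡ (hub c) y y′ (cong proj₁ eq))

    shrink-segPt : ∀ c s A C → shrink c (segPt s A C) ≡ segPt s (shrink c A) (shrink c C)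
    shrink-segPt c s (a₁ , a₂) (c₁ , c₂) = cong₂ _,_ (first (hub c) a₂ c₂ s) (second ε a₁ c₁ s)
      where
      first : ∀ h a c s → h - (a + s * (c - a)) ≡ (h - a) + s * ((h - c) - (h - a))
      first = solve-∀ ℚ-ring
      second : ∀ e a c s → e * (a + s * (c - a)) ≡ e * a + s * (e * c - e * a)
      second = solve-∀ ℚ-ring

    shrink-disjoint : ∀ a b {p q} → Triangle p → Triangle q → shrink a p ≡ shrink b q → a ≡ b
    shrink-disjoint a b {_ , y} {_ , y′} p∈T q∈T eq = slot-unique
      (slot-around-hub a (within1-triangle p∈T))
      (subst (Slot b) (sym (cong proj₁ eq)) (slot-around-hub b (within1-triangle q∈T)))

    pole≢shrink : ∀ t b {p} → Triangle p → pole t ≢ shrink b p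
    pole≢shrink t b {_ , y} p∈T eq =
      <-irrefl (cong proj₁ eq) (slot-pos (slot-around-hub b (within1-triangle p∈T)))

    fan-coords : ∀ t c t′ s → fan t c t′ s ≡ (s * foot c t′ , sign t * (1ℚ - s))
    fan-coords t c t′ s = cong₂ _,_ (first s (foot c t′)) (second (sign t) s ε)
      where
      first : ∀ s f → 0ℚ + s * (f - 0ℚ) ≡ s * f
      first = solve-∀ ℚ-ring
      second : ∀ σ s e → σ + s * (e * 0ℚ - σ) ≡ σ * (1ℚ - s)
      second = solve-∀ ℚ-ring

    fans-coords : ∀ t u c t′ d u′ s s′ → fan t c t′ s ≡ fan u d u′ s′ →
             (s * foot c t′ , sign t * (1ℚ - s)) ≡ (s′ * foot d u′ , sign u * (1ℚ - s′))
    fans-coords t u c t′ d u′ s s′ eq = trans (sym (fan-coords t c t′ s)) (trans eq (fan-coords u d u′ s′))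

    fan-segPt : ∀ t c t′ s → fan t c t′ s ≡ segPt s (pole t) (shrink c (pole t′))
    fan-segPt t c t′ s = refl

    fan-start : ∀ t c t′ → fan t c t′ 0ℚ ≡ pole t
    fan-start t c t′ = segPt-0 (pole t) (shrink c (pole t′))

    fan-end : ∀ t c t′ → fan t c t′ 1ℚ ≡ shrink c (pole t′)
    fan-end t c t′ = segPt-1 (pole t) (shrink c (pole t′))

    triangle-fan : ∀ t c t′ {s} → InUnit s → Triangle (fan t c t′ s)
    triangle-fan t c t′ {s} s∈I@(0≤s , _) = subst Triangle (sym (fan-coords t c t′ s)) (triangle
      (nonNeg*nonNeg 0≤s 0≤q)
      (subst (0ℚ ≤_) (lower B q (sign t) s) (nonNeg+nonNeg (nonNeg*nonNeg 0≤s 0≤B-q) (nonNeg*nonNeg 0≤B (nonNeg*nonNeg 0≤1-s 0≤1-σ))))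
      (subst (0ℚ ≤_) (upper B q (sign t) s) (nonNeg+nonNeg (nonNeg*nonNeg 0≤s 0≤B-q) (nonNeg*nonNeg 0≤B (nonNeg*nonNeg 0≤1-s 0≤1+σ)))))
      where
      q : ℚ
      q = foot c t′
      0≤q : 0ℚ ≤ q
      0≤q = <⇒≤ (slot-pos (foot∈slot c t′))
      0≤B-q : 0ℚ ≤ B - q
      0≤B-q = <⇒≤ (slot-<B (foot∈slot c t′))
      0≤1-s : 0ℚ ≤ 1ℚ - s
      0≤1-s = 1-s-nonNeg s∈I
      0≤1-σ : 0ℚ ≤ 1ℚ - sign t
      0≤1-σ = Within1.upper (sign-within1 t)
      0≤1+σ : 0ℚ ≤ 1ℚ + sign t
      0≤1+σ = Within1.lower (sign-within1 t)
      lower : ∀ b q σ s → s * (b - q) + b * ((1ℚ - s) * (1ℚ - σ)) ≡ b - (s * q + b * (σ * (1ℚ - s)))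
      lower = solve-∀ ℚ-ring
      upper : ∀ b q σ s → s * (b - q) + b * ((1ℚ - s) * (1ℚ + σ)) ≡ b - (s * q - b * (σ * (1ℚ - s)))
      upper = solve-∀ ℚ-ring

    pole-on-fan : ∀ v t c t′ s → pole v ≡ fan t c t′ s → v ≡ t
    pole-on-fan v t c t′ s eq = sign-injective (cong proj₂ (begin
      pole v           ≡⟨ eq ⟩
      fan t c t′ s     ≡⟨ cong (fan t c t′) s≡0 ⟩
      fan t c t′ 0ℚ    ≡⟨ fan-start t c t′ ⟩
      pole t           ∎))
      where
      open ≡-Reasoning
      s≡0 : s ≡ 0ℚ
      s≡0 = zero-cancelˡ (slot-pos (foot∈slot c t′))
        (trans (*-comm (foot c t′) s) (sym (cong proj₁ (trans eq (fan-coords t c t′ s)))))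

    foot-injective : ∀ c d t u → foot c t ≡ foot d u → c ≡ d × t ≡ u
    foot-injective c d t u eq =
      c≡d , sign-injective (-‿cancelˡ (hub c) (sign t) (sign u) (trans eq (cong (λ h → h - sign u) (cong hub (sym c≡d)))))
      where
      c≡d : c ≡ d
      c≡d = slot-unique (foot∈slot c t) (subst (Slot d) (sym eq) (foot∈slot d u))

  module UpperFanPoint {q s h y₁ y₂ : ℚ} (s∈I : InUnit s) (p∈T : Triangle (y₁ , y₂)) (0≤q : 0ℚ ≤ q) (0≤B-q : 0ℚ ≤ B - q)
                       (x-eq : s * q ≡ h - y₂) (y-eq : 1ℚ - s ≡ ε * y₁) where

    open ≡-Reasoning

    y₂∈I : Within1 y₂
    y₂∈I = within1-triangle p∈T

    h-sq≡y₂ : h - s * q ≡ y₂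
    h-sq≡y₂ = trans (cong (λ u → h - u) x-eq) (p-[p-q]≡q h y₂)

    lower-gap : q - (h - 1ℚ) ≡ (1ℚ - y₂) + q * (1ℚ - s)
    lower-gap = begin
      q - (h - 1ℚ)                        ≡⟨ rearrange q s h ⟩
      (1ℚ - (h - s * q)) + q * (1ℚ - s)   ≡⟨ cong (λ u → (1ℚ - u) + q * (1ℚ - s)) h-sq≡y₂ ⟩
      (1ℚ - y₂) + q * (1ℚ - s)            ∎
      where
      rearrange : ∀ q s h → q - (h - 1ℚ) ≡ (1ℚ - (h - s * q)) + q * (1ℚ - s)
      rearrange = solve-∀ ℚ-ring

    P Q R : ℚ
    P = (1ℚ - ε * (B * B)) * (1ℚ + y₂)
    Q = (ε * B * (B - q)) * (1ℚ + y₂)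
    R = (ε * q) * (B - (y₁ - B * y₂))

    -- ε B² ≤ 1 is needed here: it keeps the image of the triangle below the fan
    upper-gap : (h + 1ℚ) - q ≡ (P + Q) + R
    upper-gap = begin
      (h + 1ℚ) - q                        ≡⟨ rearrange q s h ⟩
      (1ℚ + (h - s * q)) - q * (1ℚ - s)   ≡⟨ cong₂ (λ u v → (1ℚ + u) - q * v) h-sq≡y₂ y-eq ⟩
      (1ℚ + y₂) - q * (ε * y₁)            ≡⟨ certificate B ε q y₁ y₂ ⟩
      (P + Q) + R                         ∎
      where
      rearrange : ∀ q s h → (h + 1ℚ) - q ≡ (1ℚ + (h - s * q)) - q * (1ℚ - s)
      rearrange = solve-∀ ℚ-ring
      certificate : ∀ b e q y₁ y₂ → (1ℚ + y₂) - q * (e * y₁) ≡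
        ((1ℚ - e * (b * b)) * (1ℚ + y₂) + (e * b * (b - q)) * (1ℚ + y₂)) + (e * q) * (b - (y₁ - b * y₂))
      certificate = solve-∀ ℚ-ring

    0≤P : 0ℚ ≤ P
    0≤P = nonNeg*nonNeg 0≤1-εBB (Within1.lower y₂∈I)

    0≤Q : 0ℚ ≤ Q
    0≤Q = nonNeg*nonNeg (nonNeg*nonNeg (nonNeg*nonNeg 0≤ε 0≤B) 0≤B-q) (Within1.lower y₂∈I)

    0≤R : 0ℚ ≤ R
    0≤R = nonNeg*nonNeg (nonNeg*nonNeg 0≤ε 0≤q) (Triangle.above-lower-side p∈T)

    lower-gap-nonNeg : 0ℚ ≤ q - (h - 1ℚ)
    lower-gap-nonNeg = subst (0ℚ ≤_) (sym lower-gap) (nonNeg+nonNeg (Within1.upper y₂∈I) (nonNeg*nonNeg 0≤q (1-s-nonNeg s∈I)))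

    upper-gap-nonNeg : 0ℚ ≤ (h + 1ℚ) - q
    upper-gap-nonNeg = subst (0ℚ ≤_) (sym upper-gap) (nonNeg+nonNeg (nonNeg+nonNeg 0≤P 0≤Q) 0≤R)

    lower-gap≡0⇒s≡1 : 0ℚ < q → q - (h - 1ℚ) ≡ 0ℚ → s ≡ 1ℚ
    lower-gap≡0⇒s≡1 0<q gap≡0 = 1-s≡0⇒s≡1 (zero-cancelˡ 0<q (proj₂
      (nonNeg+nonNeg≡0 (Within1.upper y₂∈I) (nonNeg*nonNeg 0≤q (1-s-nonNeg s∈I)) (trans (sym lower-gap) gap≡0))))

    upper-gap≡0⇒s≡1 : 0ℚ < q → 0ℚ < B - q → (h + 1ℚ) - q ≡ 0ℚ → s ≡ 1ℚ
    upper-gap≡0⇒s≡1 0<q 0<B-q gap≡0 = 1-s≡0⇒s≡1 (trans y-eq (trans (cong (ε *_) y₁≡0) (*-zeroʳ ε)))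
      where
      P+Q≡0×R≡0 : P + Q ≡ 0ℚ × R ≡ 0ℚ
      P+Q≡0×R≡0 = nonNeg+nonNeg≡0 (nonNeg+nonNeg 0≤P 0≤Q) 0≤R (trans (sym upper-gap) gap≡0)
      1+y₂≡0 : 1ℚ + y₂ ≡ 0ℚ
      1+y₂≡0 = zero-cancelˡ (pos*pos (pos*pos 0<ε 0<B) 0<B-q) (proj₂ (nonNeg+nonNeg≡0 0≤P 0≤Q (proj₁ P+Q≡0×R≡0)))
      side≡0 : B - (y₁ - B * y₂) ≡ 0ℚ
      side≡0 = zero-cancelˡ (pos*pos 0<ε 0<q) (proj₂ P+Q≡0×R≡0)
      y₁≡0 : y₁ ≡ 0ℚ
      y₁≡0 = begin
        y₁                                      ≡⟨ split B y₁ y₂ ⟩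
        B * (1ℚ + y₂) - (B - (y₁ - B * y₂))     ≡⟨ cong₂ (λ u v → B * u - v) 1+y₂≡0 side≡0 ⟩
        B * 0ℚ - 0ℚ                             ≡⟨ b0-0≡0 B ⟩
        0ℚ                                      ∎
        where
        split : ∀ b y₁ y₂ → y₁ ≡ b * (1ℚ + y₂) - (b - (y₁ - b * y₂))
        split = solve-∀ ℚ-ring
        b0-0≡0 : ∀ b → b * 0ℚ - 0ℚ ≡ 0ℚ
        b0-0≡0 = solve-∀ ℚ-ring

  opaque
    unfolding sign shrink foot

    upper-fan-meets-shrink⇒s≡1 : ∀ c t′ s b {y₁ y₂} → InUnit s → Triangle (y₁ , y₂) →
                                 s * foot c t′ ≡ hub b - y₂ → 1ℚ - s ≡ ε * y₁ → s ≡ 1ℚ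
    upper-fan-meets-shrink⇒s≡1 c true s b s∈I p∈T x-eq y-eq =
      lower-gap≡0⇒s≡1 (slot-pos (foot∈slot c true)) (trans (cong (λ h → (hub c - 1ℚ) - (h - 1ℚ)) (cong hub b≡c)) (+-inverseʳ (hub c - 1ℚ)))
      where
      open UpperFanPoint {h = hub b} s∈I p∈T (<⇒≤ (slot-pos (foot∈slot c true))) (<⇒≤ (slot-<B (foot∈slot c true))) x-eq y-eq
      b≡c : b ≡ c
      b≡c = slot-unique (slot lower-gap-nonNeg upper-gap-nonNeg) (foot∈slot c true)
    upper-fan-meets-shrink⇒s≡1 c false s b s∈I p∈T x-eq y-eq =
      upper-gap≡0⇒s≡1 (slot-pos (foot∈slot c false)) (slot-<B (foot∈slot c false))
        (trans (cong (λ h → (h + 1ℚ) - foot c false) (cong hub b≡c)) (h+1-[h--1]≡0 (hub c)))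
      where
      open UpperFanPoint {h = hub b} s∈I p∈T (<⇒≤ (slot-pos (foot∈slot c false))) (<⇒≤ (slot-<B (foot∈slot c false))) x-eq y-eq
      b≡c : b ≡ c
      b≡c = slot-unique (slot lower-gap-nonNeg upper-gap-nonNeg) (foot∈slot c false)
      h+1-[h--1]≡0 : ∀ h → (h + 1ℚ) - (h - - 1ℚ) ≡ 0ℚ
      h+1-[h--1]≡0 = solve-∀ ℚ-ring

    fan-meets-shrink⇒s≡1 : ∀ t c t′ s b {p} → InUnit s → Triangle p → fan t c t′ s ≡ shrink b p → s ≡ 1ℚ
    fan-meets-shrink⇒s≡1 true c t′ s b {y₁ , y₂} s∈I p∈T eq =
      upper-fan-meets-shrink⇒s≡1 c t′ s b s∈I p∈T (cong proj₁ coords) (trans (sym (*-identityˡ (1ℚ - s))) (cong proj₂ coords))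
      where
      coords : (s * foot c t′ , 1ℚ * (1ℚ - s)) ≡ (hub b - y₂ , ε * y₁)
      coords = trans (sym (fan-coords true c t′ s)) eq
    fan-meets-shrink⇒s≡1 false c t′ s b {y₁ , y₂} s∈I p∈T eq =
      1-s≡0⇒s≡1 (proj₁ (nonNeg+nonNeg≡0 (1-s-nonNeg s∈I) (nonNeg*nonNeg 0≤ε (Triangle.right-of-axis p∈T)) sum≡0))
      where
      y-eq : - 1ℚ * (1ℚ - s) ≡ ε * y₁
      y-eq = cong proj₂ (trans (sym (fan-coords false c t′ s)) eq)
      sum≡0 : (1ℚ - s) + ε * y₁ ≡ 0ℚ
      sum≡0 = trans (cong ((1ℚ - s) +_) (sym y-eq)) (u-u≡0 (1ℚ - s))
        where
        u-u≡0 : ∀ u → u + - 1ℚ * u ≡ 0ℚ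
        u-u≡0 = solve-∀ ℚ-ring

    fan-meets-shrink : ∀ t c t′ s b {p} → InUnit s → Triangle p → fan t c t′ s ≡ shrink b p → b ≡ c × p ≡ pole t′
    fan-meets-shrink t c t′ s b {p} s∈I p∈T eq =
      sym c≡b , sym (shrink-injective c (pole t′) p (trans at-end (cong (λ a → shrink a p) (sym c≡b))))
      where
      at-end : shrink c (pole t′) ≡ shrink b p
      at-end = trans (sym (fan-end t c t′)) (trans (cong (fan t c t′) (sym (fan-meets-shrink⇒s≡1 t c t′ s b s∈I p∈T eq))) eq)
      c≡b : c ≡ b
      c≡b = shrink-disjoint c b (triangle-pole t′) p∈T at-end

    fans-from-one-pole-meet : ∀ t c t′ d u′ s s′ → InUnit s →
      s * foot c t′ ≡ s′ * foot d u′ → 1ℚ - s ≡ 1ℚ - s′ → FanMeeting t c t′ t d u′ s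
    fans-from-one-pole-meet t c t′ d u′ s s′ s∈I x-eq y-eq with nonNeg⇒≡0⊎pos (proj₁ s∈I)
    ... | inj₁ s≡0 = at-pole refl (trans (cong (fan t c t′) s≡0) (fan-start t c t′))
    ... | inj₂ 0<s = same-fan refl (proj₁ feet) (proj₂ feet)
      where
      s≡s′ : s ≡ s′
      s≡s′ = -‿cancelˡ 1ℚ s s′ y-eq
      feet : c ≡ d × t′ ≡ u′
      feet = foot-injective c d t′ u′ (*-cancelˡ-pos 0<s (trans x-eq (cong (_* foot d u′) (sym s≡s′))))

    fans-from-opposite-poles-meet : ∀ t c t′ u d u′ s s′ → InUnit s → InUnit s′ →
      s * foot c t′ ≡ s′ * foot d u′ → (1ℚ - s) + (1ℚ - s′) ≡ 0ℚ → FanMeeting t c t′ u d u′ s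
    fans-from-opposite-poles-meet t c t′ u d u′ s s′ s∈I s′∈I x-eq sum≡0 =
      at-foot (proj₁ feet) (proj₂ feet) (trans (cong (fan t c t′) s≡1) (fan-end t c t′))
      where
      both≡0 : 1ℚ - s ≡ 0ℚ × 1ℚ - s′ ≡ 0ℚ
      both≡0 = nonNeg+nonNeg≡0 (1-s-nonNeg s∈I) (1-s-nonNeg s′∈I) sum≡0
      s≡1 : s ≡ 1ℚ
      s≡1 = 1-s≡0⇒s≡1 (proj₁ both≡0)
      s′≡1 : s′ ≡ 1ℚ
      s′≡1 = 1-s≡0⇒s≡1 (proj₂ both≡0)
      feet : c ≡ d × t′ ≡ u′
      feet = foot-injective c d t′ u′ (*-cancelˡ-pos (positive⁻¹ 1ℚ)
        (trans (cong (_* foot c t′) (sym s≡1)) (trans x-eq (cong (_* foot d u′) s′≡1))))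

    fans-meet : ∀ t c t′ u d u′ s s′ → InUnit s → InUnit s′ → fan t c t′ s ≡ fan u d u′ s′ → FanMeeting t c t′ u d u′ s
    fans-meet true  c t′ true  d u′ s s′ s∈I s′∈I eq = fans-from-one-pole-meet true c t′ d u′ s s′ s∈I
      (cong proj₁ (fans-coords true true c t′ d u′ s s′ eq))
      (trans (sym (*-identityˡ (1ℚ - s))) (trans (cong proj₂ (fans-coords true true c t′ d u′ s s′ eq)) (*-identityˡ (1ℚ - s′))))
    fans-meet false c t′ false d u′ s s′ s∈I s′∈I eq = fans-from-one-pole-meet false c t′ d u′ s s′ s∈I
      (cong proj₁ (fans-coords false false c t′ d u′ s s′ eq))
      (neg-injective (trans (sym (-1*p≡-p (1ℚ - s))) (trans (cong proj₂ (fans-coords false false c t′ d u′ s s′ eq)) (-1*p≡-p (1ℚ - s′)))))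
      where
      -1*p≡-p : ∀ p → - 1ℚ * p ≡ - p
      -1*p≡-p = solve-∀ ℚ-ring
    fans-meet true  c t′ false d u′ s s′ s∈I s′∈I eq = fans-from-opposite-poles-meet true c t′ false d u′ s s′ s∈I s′∈I
      (cong proj₁ (fans-coords true false c t′ d u′ s s′ eq))
      (trans (split (1ℚ - s) (1ℚ - s′)) (trans (cong (_- (- 1ℚ * (1ℚ - s′))) (cong proj₂ (fans-coords true false c t′ d u′ s s′ eq))) (+-inverseʳ (- 1ℚ * (1ℚ - s′)))))
      where
      split : ∀ a b → a + b ≡ 1ℚ * a - (- 1ℚ * b)
      split = solve-∀ ℚ-ring
    fans-meet false c t′ true  d u′ s s′ s∈I s′∈I eq = fans-from-opposite-poles-meet false c t′ true d u′ s s′ s∈I s′∈I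
      (cong proj₁ (fans-coords false true c t′ d u′ s s′ eq))
      (trans (split (1ℚ - s) (1ℚ - s′)) (trans (cong (_- (- 1ℚ * (1ℚ - s))) (sym (cong proj₂ (fans-coords false true c t′ d u′ s s′ eq)))) (+-inverseʳ (- 1ℚ * (1ℚ - s)))))
      where
      split : ∀ a b → a + b ≡ 1ℚ * b - (- 1ℚ * a)
      split = solve-∀ ℚ-ring

module DoubledTree (N : ℕ) where

  open import Data.Bool.Base using (Bool; false; not)
  import Data.Bool.Properties as Bool
  open import Data.Empty using (⊥-elim)
  open import Data.List.Base using (_∷_; [_]; length)
  open import Data.Nat.Base using (zero; suc)
  open import Data.Product.Base using (Σ; proj₁; proj₂)
  import Data.Product.Base as Product
  open import Data.Rational.Base using (ℚ; 1ℚ; _-_)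
  open import Data.Sum.Base using (inj₁; inj₂)
  import Data.Sum.Base as Sum
  open import Relation.Binary.PropositionalEquality hiding ([_])
  open import Relation.Nullary.Negation.Core using (¬_)
  open Fan N
  open Segment using (segPt-swap; InUnit-swap)

  Vertex : Set
  Vertex = List (Fin N) × Bool

  shrink* : List (Fin N) → Point → Point
  shrink* []      p = p
  shrink* (c ∷ L) p = shrink c (shrink* L p)

  place : Vertex → Point
  place (L , t) = shrink* L (pole t)

  record Edge : Set where
    constructor edge
    field
      base  : List (Fin N)
      from  : Bool
      child : Fin N
      to    : Bool

  open Edge

  source : Edge → Vertex
  source e = base e , from e

  target : Edge → Vertex
  target e = base e ∷ʳ child e , to e

  edgePoint : Edge → ℚ → Point
  edgePoint e s = shrink* (base e) (fan (from e) (child e) (to e) s)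

  EndOf : Vertex → Edge → Set
  EndOf v e = v ≡ source e ⊎ v ≡ target e

  _∷ᵛ_ : Fin N → Vertex → Vertex
  a ∷ᵛ (L , t) = a ∷ L , t

  _∷ᵉ_ : Fin N → Edge → Edge
  a ∷ᵉ edge L t c t′ = edge (a ∷ L) t c t′

  EndOf-∷ : ∀ a {v e} → EndOf v e → EndOf (a ∷ᵛ v) (a ∷ᵉ e)
  EndOf-∷ a = Sum.map (cong (a ∷ᵛ_)) (cong (a ∷ᵛ_))

  triangle-shrink* : ∀ L {p} → Triangle p → Triangle (shrink* L p)
  triangle-shrink* []      p∈T = p∈T
  triangle-shrink* (c ∷ L) p∈T = triangle-shrink c (triangle-shrink* L p∈T)

  triangle-place : ∀ v → Triangle (place v)
  triangle-place (L , t) = triangle-shrink* L (triangle-pole t)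

  triangle-edgePoint : ∀ e {s} → InUnit s → Triangle (edgePoint e s)
  triangle-edgePoint (edge L t c t′) s∈I = triangle-shrink* L (triangle-fan t c t′ s∈I)

  shrink*-segPt : ∀ L s A C → shrink* L (segPt s A C) ≡ segPt s (shrink* L A) (shrink* L C)
  shrink*-segPt []      s A C = refl
  shrink*-segPt (c ∷ L) s A C = trans (cong (shrink c) (shrink*-segPt L s A C)) (shrink-segPt c s _ _)

  shrink*-∷ʳ : ∀ L c p → shrink* (L ∷ʳ c) p ≡ shrink* L (shrink c p)
  shrink*-∷ʳ []      c p = refl
  shrink*-∷ʳ (a ∷ L) c p = cong (shrink a) (shrink*-∷ʳ L c p)

  edgePoint-segPt : ∀ e s → edgePoint e s ≡ segPt s (place (source e)) (place (target e))
  edgePoint-segPt (edge L t c t′) s = begin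
    shrink* L (fan t c t′ s)                                   ≡⟨ cong (shrink* L) (fan-segPt t c t′ s) ⟩
    shrink* L (segPt s (pole t) (shrink c (pole t′)))          ≡⟨ shrink*-segPt L s (pole t) (shrink c (pole t′)) ⟩
    segPt s (place (L , t)) (shrink* L (shrink c (pole t′)))   ≡⟨ cong (segPt s (place (L , t))) (shrink*-∷ʳ L c (pole t′)) ⟨
    segPt s (place (L , t)) (place (L ∷ʳ c , t′))              ∎
    where open ≡-Reasoning

  place-injective : ∀ v w → place v ≡ place w → v ≡ w
  place-injective ([]    , v) ([]    , t) eq = cong ([] ,_) (pole-injective v t eq)
  place-injective ([]    , v) (a ∷ L , t) eq = ⊥-elim (pole≢shrink v a (triangle-place (L , t)) eq)
  place-injective (b ∷ M , v) ([]    , t) eq = ⊥-elim (pole≢shrink t b (triangle-place (M , v)) (sym eq))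
  place-injective (b ∷ M , v) (a ∷ L , t) eq = cong₂ _∷ᵛ_ b≡a
    (place-injective (M , v) (L , t) (shrink-injective b (place (M , v)) (place (L , t))
      (trans eq (cong (λ c → shrink c (place (L , t))) (sym b≡a)))))
    where
    b≡a : b ≡ a
    b≡a = shrink-disjoint b a (triangle-place (M , v)) (triangle-place (L , t)) eq

  vertex-on-edge : ∀ v e s → InUnit s → place v ≡ edgePoint e s → EndOf v e
  vertex-on-edge ([] , v) (edge [] t c t′) s s∈I eq = inj₁ (cong ([] ,_) (pole-on-fan v t c t′ s eq))
  vertex-on-edge ([] , v) (edge (a ∷ L) t c t′) s s∈I eq =
    ⊥-elim (pole≢shrink v a (triangle-edgePoint (edge L t c t′) s∈I) eq)
  vertex-on-edge (b ∷ M , v) (edge [] t c t′) s s∈I eq =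
    inj₂ (cong₂ _∷ᵛ_ (proj₁ meet) (place-injective (M , v) ([] , t′) (proj₂ meet)))
    where
    meet : b ≡ c × place (M , v) ≡ pole t′
    meet = fan-meets-shrink t c t′ s b s∈I (triangle-place (M , v)) (sym eq)
  vertex-on-edge (b ∷ M , v) (edge (a ∷ L) t c t′) s s∈I eq =
    subst (λ x → EndOf (b ∷ M , v) (x ∷ᵉ edge L t c t′)) b≡a (EndOf-∷ b (vertex-on-edge (M , v) (edge L t c t′) s s∈I
      (shrink-injective b (place (M , v)) (edgePoint (edge L t c t′) s)
        (trans eq (cong (λ x → shrink x (edgePoint (edge L t c t′) s)) (sym b≡a))))))
    where
    b≡a : b ≡ a
    b≡a = shrink-disjoint b a (triangle-place (M , v)) (triangle-edgePoint (edge L t c t′) s∈I) eq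

  data EdgeMeeting (e e′ : Edge) (s : ℚ) : Set where
    same-edge  : e ≡ e′ → EdgeMeeting e e′ s
    common-end : ∀ v → EndOf v e → EndOf v e′ → place v ≡ edgePoint e s → EdgeMeeting e e′ s

  swap-meeting : ∀ {e e′ s s′} → edgePoint e s ≡ edgePoint e′ s′ → EdgeMeeting e′ e s′ → EdgeMeeting e e′ s
  swap-meeting eq (same-edge e′≡e)            = same-edge (sym e′≡e)
  swap-meeting eq (common-end v end′ end pt) = common-end v end end′ (trans pt (sym eq))

  push-meeting : ∀ a {e e′ s} → EdgeMeeting e e′ s → EdgeMeeting (a ∷ᵉ e) (a ∷ᵉ e′) s
  push-meeting a (same-edge e≡e′)           = same-edge (cong (a ∷ᵉ_) e≡e′)
  push-meeting a (common-end v end end′ pt) = common-end (a ∷ᵛ v) (EndOf-∷ a end) (EndOf-∷ a end′) (cong (shrink a) pt)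

  fan-meeting⇒edge-meeting : ∀ {t c t′ u d u′ s} → FanMeeting t c t′ u d u′ s → EdgeMeeting (edge [] t c t′) (edge [] u d u′) s
  fan-meeting⇒edge-meeting (same-fan refl refl refl)       = same-edge refl
  fan-meeting⇒edge-meeting {t = t} (at-pole refl pt)       = common-end ([] , t) (inj₁ refl) (inj₁ refl) (sym pt)
  fan-meeting⇒edge-meeting {c = c} {t′} (at-foot refl refl pt) = common-end ([ c ] , t′) (inj₂ refl) (inj₂ refl) (sym pt)

  root-edge-meets-deeper-edge : ∀ t c t′ b e′ s s′ → InUnit s → InUnit s′ →
    edgePoint (edge [] t c t′) s ≡ edgePoint (b ∷ᵉ e′) s′ → EdgeMeeting (edge [] t c t′) (b ∷ᵉ e′) s
  root-edge-meets-deeper-edge t c t′ b e′ s s′ s∈I s′∈I eq =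
    common-end ([ b ] , t′) (inj₂ (cong (λ x → [ x ] , t′) (proj₁ meet))) (EndOf-∷ b end′)
      (trans (cong (shrink b) (sym (proj₂ meet))) (sym eq))
    where
    meet : b ≡ c × edgePoint e′ s′ ≡ pole t′
    meet = fan-meets-shrink t c t′ s b s∈I (triangle-edgePoint e′ s′∈I) eq
    end′ : EndOf ([] , t′) e′
    end′ = vertex-on-edge ([] , t′) e′ s′ s′∈I (sym (proj₂ meet))

  edges-meet : ∀ e e′ s s′ → InUnit s → InUnit s′ → edgePoint e s ≡ edgePoint e′ s′ → EdgeMeeting e e′ s
  edges-meet (edge [] t c t′) (edge [] u d u′) s s′ s∈I s′∈I eq =
    fan-meeting⇒edge-meeting (fans-meet t c t′ u d u′ s s′ s∈I s′∈I eq)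
  edges-meet (edge [] t c t′) (edge (b ∷ M) u d u′) s s′ s∈I s′∈I eq =
    root-edge-meets-deeper-edge t c t′ b (edge M u d u′) s s′ s∈I s′∈I eq
  edges-meet (edge (a ∷ L) t c t′) (edge [] u d u′) s s′ s∈I s′∈I eq =
    swap-meeting eq (root-edge-meets-deeper-edge u d u′ a (edge L t c t′) s′ s s′∈I s∈I (sym eq))
  edges-meet (edge (a ∷ L) t c t′) (edge (b ∷ M) u d u′) s s′ s∈I s′∈I eq =
    subst (λ x → EdgeMeeting (edge (a ∷ L) t c t′) (x ∷ᵉ edge M u d u′) s) a≡b (push-meeting a
      (edges-meet (edge L t c t′) (edge M u d u′) s s′ s∈I s′∈I
        (shrink-injective a (edgePoint (edge L t c t′) s) (edgePoint (edge M u d u′) s′)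
          (trans eq (cong (λ x → shrink x (edgePoint (edge M u d u′) s′)) (sym a≡b))))))
    where
    a≡b : a ≡ b
    a≡b = shrink-disjoint a b (triangle-edgePoint (edge L t c t′) s∈I) (triangle-edgePoint (edge M u d u′) s′∈I) eq

  SamePair : Vertex → Vertex → Vertex → Vertex → Set
  SamePair v w x y = (v ≡ x × w ≡ y) ⊎ (v ≡ y × w ≡ x)

  Linked : Vertex → Vertex → Set
  Linked v w = Σ Edge λ e → SamePair v w (source e) (target e)

  SamePair-common : ∀ {v w v′ w′ x y} → SamePair v w x y → SamePair v′ w′ x y → SamePair v w v′ w′
  SamePair-common (inj₁ (refl , refl)) (inj₁ (refl , refl)) = inj₁ (refl , refl)
  SamePair-common (inj₁ (refl , refl)) (inj₂ (refl , refl)) = inj₂ (refl , refl)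
  SamePair-common (inj₂ (refl , refl)) (inj₁ (refl , refl)) = inj₂ (refl , refl)
  SamePair-common (inj₂ (refl , refl)) (inj₂ (refl , refl)) = inj₁ (refl , refl)

  SamePair-end : ∀ {u v w x y} → SamePair v w x y → u ≡ x ⊎ u ≡ y → u ≡ v ⊎ u ≡ w
  SamePair-end (inj₁ (refl , refl)) u∈xy = u∈xy
  SamePair-end (inj₂ (refl , refl)) u∈xy = Sum.swap u∈xy

  linked-segment : ∀ {v w} ((e , vw) : Linked v w) s → InUnit s →
                   Σ ℚ λ s′ → InUnit s′ × segPt s (place v) (place w) ≡ edgePoint e s′
  linked-segment (e , inj₁ (refl , refl)) s s∈I = s , s∈I , sym (edgePoint-segPt e s)
  linked-segment (e , inj₂ (refl , refl)) s s∈I =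
    1ℚ - s , InUnit-swap s∈I , trans (segPt-swap s (place (target e)) (place (source e))) (sym (edgePoint-segPt e (1ℚ - s)))

  parity : ℕ → Bool
  parity zero    = false
  parity (suc k) = not (parity k)

  level : Vertex → ℕ
  level (L , _) = length L

  level-target : ∀ e → level (target e) ≡ suc (level (source e))
  level-target (edge L t c t′) = Snoc.length-∷ʳ L c

  linked-parity : ∀ {v w} → Linked v w → parity (level v) ≢ parity (level w)
  linked-parity (e , inj₁ (refl , refl)) eq =
    Bool.not-¬ refl (trans eq (cong parity (level-target e)))
  linked-parity (e , inj₂ (refl , refl)) eq =
    Bool.not-¬ refl (trans (sym eq) (cong parity (level-target e)))

  record TreeEmbedding {m} (H : SimpleGraph m) : Set where
    field
      node           : Fin m → Vertex
      node-injective : ∀ x y → node x ≡ node y → x ≡ y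
      node-linked    : ∀ x y → Adj H x y ≡ true → Linked (node x) (node y)

  module _ {m} {H : SimpleGraph m} (emb : TreeEmbedding H) where

    open TreeEmbedding emb

    embedding⇒bipartite : Bipartite H
    embedding⇒bipartite = (λ x → parity (level (node x))) , λ x y adj → linked-parity (node-linked x y adj)

    pos : Fin m → Point
    pos x = place (node x)

    vertex-off-edges : ∀ w a b → Adj H a b ≡ true → ∀ s → InUnit s → pos w ≡ segPt s (pos a) (pos b) → w ≡ a ⊎ w ≡ b
    vertex-off-edges w a b adj s s∈I eq with node-linked a b adj | linked-segment (node-linked a b adj) s s∈I
    ... | e , ends | s′ , s′∈I , seg = Sum.map (node-injective w a) (node-injective w b)
      (SamePair-end ends (vertex-on-edge (node w) e s′ s′∈I (trans eq seg)))

    same-pair⇒same-edge : ∀ {a b c d} → SamePair (node a) (node b) (node c) (node d) → SameEdge a b c d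
    same-pair⇒same-edge {a} {b} {c} {d} =
      Sum.map (Product.map (node-injective a c) (node-injective b d)) (Product.map (node-injective a d) (node-injective b c))

    common-vertex : ∀ {a b c d} v → v ≡ node a ⊎ v ≡ node b → v ≡ node c ⊎ v ≡ node d →
                    Σ (Fin m) λ w → (w ≡ a ⊎ w ≡ b) × (w ≡ c ⊎ w ≡ d) × node w ≡ v
    common-vertex {a} {b} {c} {d} v (inj₁ refl) v∈cd = a , inj₁ refl , Sum.map (node-injective a c) (node-injective a d) v∈cd , refl
    common-vertex {a} {b} {c} {d} v (inj₂ refl) v∈cd = b , inj₂ refl , Sum.map (node-injective b c) (node-injective b d) v∈cd , refl

    edges-cross-only-at-ends : ∀ a b c d → Adj H a b ≡ true → Adj H c d ≡ true → ¬ SameEdge a b c d →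
      ∀ s t → InUnit s → InUnit t → segPt s (pos a) (pos b) ≡ segPt t (pos c) (pos d) →
      Σ (Fin m) λ w → (w ≡ a ⊎ w ≡ b) × (w ≡ c ⊎ w ≡ d) × pos w ≡ segPt s (pos a) (pos b)
    edges-cross-only-at-ends a b c d adj₁ adj₂ ¬same s t s∈I t∈I eq
      with node-linked a b adj₁ | linked-segment (node-linked a b adj₁) s s∈I
         | node-linked c d adj₂ | linked-segment (node-linked c d adj₂) t t∈I
    ... | e₁ , ends₁ | s′ , s′∈I , seg₁ | e₂ , ends₂ | t′ , t′∈I , seg₂
      with edges-meet e₁ e₂ s′ t′ s′∈I t′∈I (trans (sym seg₁) (trans eq seg₂))
    ... | same-edge e₁≡e₂ =
      ⊥-elim (¬same (same-pair⇒same-edge (SamePair-common ends₁ (subst (λ e → SamePair _ _ (source e) (target e)) (sym e₁≡e₂) ends₂))))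
    ... | common-end v end₁ end₂ pt with common-vertex v (SamePair-end ends₁ end₁) (SamePair-end ends₂ end₂)
    ...   | w , w∈ab , w∈cd , refl = w , w∈ab , w∈cd , trans pt (sym seg₁)

    embedding⇒planar : Planar H
    embedding⇒planar = record
      { pos      = pos
      ; pos-inj  = λ {x} {y} eq → node-injective x y (place-injective (node x) (node y) eq)
      ; vert-off = vertex-off-edges
      ; edges-ok = edges-cross-only-at-ends
      }

record Rooted {n} (G : SimpleGraph n) : Set where
  field
    root        : Fin n
    parent      : Fin n → Fin n
    path        : Fin n → List (Fin n)
    path-root   : path root ≡ []
    path-parent : ∀ x → x ≢ root → path x ≡ path (parent x) ∷ʳ x
    parent-adj  : ∀ x → x ≢ root → Adj G (parent x) x ≡ true
    edge-parent : ∀ a b → Adj G a b ≡ true → (b ≢ root × parent b ≡ a) ⊎ (a ≢ root × parent a ≡ b)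

module BreadthFirst {n} (G : SimpleGraph n) (connected : Connected G) (acyclic : Acyclic G) (r : Fin n) where

  import Data.Bool.Properties as Bool
  open import Data.Empty using (⊥-elim)
  open import Data.Fin.Base using (toℕ)
  import Data.Fin.Properties as Fin
  open import Data.Nat.Base
  open import Data.Nat.Properties
  open import Data.Product.Base using (Σ; proj₁; proj₂)
  open import Data.Sum.Base using (inj₁; inj₂)
  open import Function.Base using (_∘_)
  open import Relation.Binary.Definitions using (tri<; tri≈; tri>)
  open import Relation.Binary.PropositionalEquality
  open import Relation.Nullary.Decidable.Core using (Dec; yes; no; _⊎-dec_; _×-dec_)
  open import Relation.Nullary.Negation.Core using (¬_)
  open LeastNumber using (least)

  Reach : ℕ → Fin n → Set
  Reach zero    x = x ≡ r
  Reach (suc i) x = Reach i x ⊎ Σ (Fin n) λ y → Reach i y × Adj G y x ≡ true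

  reach? : ∀ i x → Dec (Reach i x)
  reach? zero    x = x Fin.≟ r
  reach? (suc i) x = reach? i x ⊎-dec Fin.any? (λ y → reach? i y ×-dec (Adj G y x Bool.≟ true))

  walk-length : ∀ {a b} → Walk G a b → ℕ
  walk-length nil        = 0
  walk-length (cons _ w) = suc (walk-length w)

  reach-along : ∀ {a x} (w : Walk G a x) i → Reach i a → Reach (walk-length w + i) x
  reach-along nil                   i ra = ra
  reach-along {a} {x} (cons adj w) i ra =
    subst (λ k → Reach k x) (+-suc (walk-length w) i) (reach-along w (suc i) (inj₂ (a , ra , adj)))

  depth-spec : ∀ x → Σ ℕ λ i → Reach i x × (∀ j → j < i → ¬ Reach j x)
  depth-spec x = least (λ i → reach? i x) _ (reach-along (connected r x) 0 refl)

  depth : Fin n → ℕ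
  depth x = proj₁ (depth-spec x)

  depth-reach : ∀ x → Reach (depth x) x
  depth-reach x = proj₁ (proj₂ (depth-spec x))

  depth-minimal : ∀ x j → j < depth x → ¬ Reach j x
  depth-minimal x = proj₂ (proj₂ (depth-spec x))

  depth-≤ : ∀ x {j} → Reach j x → depth x ≤ j
  depth-≤ x {j} rx = ≮⇒≥ (λ j<d → depth-minimal x j j<d rx)

  depth-root : depth r ≡ 0
  depth-root = n≤0⇒n≡0 (depth-≤ r refl)

  depth≡0⇒root : ∀ x → depth x ≡ 0 → x ≡ r
  depth≡0⇒root x d≡0 = subst (λ k → Reach k x) d≡0 (depth-reach x)

  depth-edge : ∀ y x → Adj G y x ≡ true → depth x ≤ suc (depth y)
  depth-edge y x adj = depth-≤ x (inj₂ (y , depth-reach y , adj))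

  parent-exists : ∀ x → x ≢ r → Σ (Fin n) λ y → Adj G y x ≡ true × suc (depth y) ≡ depth x
  parent-exists x x≢r = from-depth (depth x) refl
    where
    from-depth : ∀ k → depth x ≡ k → Σ (Fin n) λ y → Adj G y x ≡ true × suc (depth y) ≡ depth x
    from-depth zero    d≡0 = ⊥-elim (x≢r (depth≡0⇒root x d≡0))
    from-depth (suc i) d≡1+i with subst (λ k → Reach k x) d≡1+i (depth-reach x)
    ... | inj₁ rix = ⊥-elim (depth-minimal x i (≤-reflexive (sym d≡1+i)) rix)
    ... | inj₂ (y , riy , adj) = y , adj ,
      ≤-antisym (≤-trans (s≤s (depth-≤ y riy)) (≤-reflexive (sym d≡1+i))) (depth-edge y x adj)

  parent-of : ∀ x → Dec (x ≡ r) → Fin n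
  parent-of x (yes _)   = r
  parent-of x (no x≢r) = proj₁ (parent-exists x x≢r)

  parent : Fin n → Fin n
  parent x = parent-of x (x Fin.≟ r)

  parent-spec : ∀ x → x ≢ r → Adj G (parent x) x ≡ true × suc (depth (parent x)) ≡ depth x
  parent-spec x x≢r = spec (x Fin.≟ r)
    where
    spec : (x≟r : Dec (x ≡ r)) → Adj G (parent-of x x≟r) x ≡ true × suc (depth (parent-of x x≟r)) ≡ depth x
    spec (yes x≡r)  = ⊥-elim (x≢r x≡r)
    spec (no x≢r′) = proj₂ (parent-exists x x≢r′)

  nonroot : ∀ x → 0 < depth x → x ≢ r
  nonroot x 0<d refl = <-irrefl (sym depth-root) 0<d

  ancestor : ℕ → Fin n → Fin n
  ancestor zero    x = x
  ancestor (suc i) x = parent (ancestor i x)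

  ancestor-depth : ∀ i x → i ≤ depth x → depth (ancestor i x) + i ≡ depth x
  ancestor-depth zero    x _ = +-identityʳ (depth x)
  ancestor-depth (suc i) x 1+i≤d = begin
    depth (parent z) + suc i   ≡⟨ +-suc (depth (parent z)) i ⟩
    suc (depth (parent z)) + i ≡⟨ cong (_+ i) (proj₂ (parent-spec z (nonroot z 0<dz))) ⟩
    depth z + i                ≡⟨ dz+i≡d ⟩
    depth x                    ∎
    where
    open ≡-Reasoning
    z : Fin n
    z = ancestor i x
    dz+i≡d : depth z + i ≡ depth x
    dz+i≡d = ancestor-depth i x (≤-trans (n≤1+n i) 1+i≤d)
    0<dz : 0 < depth z
    0<dz = +-cancelʳ-≤ i 1 (depth z) (≤-trans 1+i≤d (≤-reflexive (sym dz+i≡d)))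

  ancestor-root : ∀ x → ancestor (depth x) x ≡ r
  ancestor-root x = depth≡0⇒root _ (+-cancelʳ-≡ (depth x) _ 0 (ancestor-depth (depth x) x ≤-refl))

  closed-path⇒cycle : ∀ k (c : ℕ → Fin n) →
    (∀ m m′ → m < 3 + k → m′ < 3 + k → c m ≡ c m′ → m ≡ m′) →
    (∀ m → suc m < 3 + k → Adj G (c m) (c (suc m)) ≡ true) →
    Adj G (c (2 + k)) (c 0) ≡ true → Cycle G
  closed-path⇒cycle k c injective step close = record
    { k     = k
    ; c     = c ∘ toℕ
    ; inj   = λ {i} {i′} eq → Fin.toℕ-injective (injective _ _ (Fin.toℕ<n i) (Fin.toℕ<n i′) eq)
    ; step  = λ i → subst (λ m → Adj G (c m) (c (suc (toℕ i))) ≡ true) (sym (Fin.toℕ-inject₁ i))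
                          (step (toℕ i) (s≤s (Fin.toℕ<n i)))
    ; close = subst (λ m → Adj G (c m) (c 0) ≡ true) (sym (Fin.toℕ-fromℕ (2 + k))) close
    }

  -- V climbs from a to the first common ancestor A j ≡ B j and descends to b.  Its
  -- vertices are told apart by their depths, and by A i ≢ B i for i < j.
  module Meeting (a b : Fin n) (a≢b : a ≢ b) (same-depth : depth a ≡ depth b) where

    D : ℕ
    D = depth a

    A B : ℕ → Fin n
    A i = ancestor i a
    B i = ancestor i b

    A-depth : ∀ i → i ≤ D → depth (A i) + i ≡ D
    A-depth i i≤D = ancestor-depth i a i≤D

    B-depth : ∀ i → i ≤ D → depth (B i) + i ≡ D
    B-depth i i≤D = trans (ancestor-depth i b (subst (i ≤_) same-depth i≤D)) (sym same-depth)

    meet-at-root : A D ≡ B D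
    meet-at-root = trans (ancestor-root a) (sym (subst (λ k → ancestor k b ≡ r) (sym same-depth) (ancestor-root b)))

    meet : Σ ℕ λ j → A j ≡ B j × (∀ i → i < j → A i ≢ B i)
    meet = least (λ i → A i Fin.≟ B i) D meet-at-root

    j : ℕ
    j = proj₁ meet

    Aj≡Bj : A j ≡ B j
    Aj≡Bj = proj₁ (proj₂ meet)

    apart : ∀ i → i < j → A i ≢ B i
    apart = proj₂ (proj₂ meet)

    j≤D : j ≤ D
    j≤D = ≮⇒≥ (λ D<j → apart D D<j meet-at-root)

    0<j : 0 < j
    0<j = n≢0⇒n>0 (λ j≡0 → a≢b (subst (λ i → A i ≡ B i) j≡0 Aj≡Bj))

    V-of : ∀ m → Dec (m ≤ j) → Fin n
    V-of m (yes _) = A m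
    V-of m (no _)  = B (j + j ∸ m)

    V : ℕ → Fin n
    V m = V-of m (m ≤? j)

    V-low : ∀ m → m ≤ j → V m ≡ A m
    V-low m m≤j with m ≤? j
    ... | yes _   = refl
    ... | no m≰j = ⊥-elim (m≰j m≤j)

    V-high : ∀ m → j ≤ m → V m ≡ B (j + j ∸ m)
    V-high m j≤m with m ≤? j
    ... | no _    = refl
    ... | yes m≤j with ≤-antisym m≤j j≤m
    ...   | refl = trans Aj≡Bj (cong B (sym (m+n∸n≡m j j)))

    mirror-< : ∀ m → j < m → m ≤ j + j → j + j ∸ m < j
    mirror-< m j<m m≤2j = subst (j + j ∸ m <_) (m+n∸n≡m j j) (∸-monoʳ-< j<m m≤2j)

    mirror-suc : ∀ N m → suc m ≤ N → N ∸ m ≡ suc (N ∸ suc m)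
    mirror-suc (suc N) zero    _         = refl
    mirror-suc (suc N) (suc m) 1+m≤1+N = mirror-suc N m (s≤s⁻¹ 1+m≤1+N)

    same-height : ∀ x {i i′} → depth x + i ≡ D → depth x + i′ ≡ D → i ≡ i′
    same-height x h h′ = +-cancelˡ-≡ (depth x) _ _ (trans h (sym h′))

    A≢B-across : ∀ m m′ → m ≤ j → j < m′ → m′ ≤ j + j → A m ≢ B (j + j ∸ m′)
    A≢B-across m m′ m≤j j<m′ m′≤2j Am≡Bk = apart m (subst (_< j) (sym m≡k) k<j) (trans Am≡Bk (cong B (sym m≡k)))
      where
      k<j : j + j ∸ m′ < j
      k<j = mirror-< m′ j<m′ m′≤2j
      m≡k : m ≡ j + j ∸ m′
      m≡k = same-height (A m) (A-depth m (≤-trans m≤j j≤D)) (subst (λ z → depth z + (j + j ∸ m′) ≡ D) (sym Am≡Bk) (B-depth _ (≤-trans (<⇒≤ k<j) j≤D)))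

    V-injective : ∀ m m′ → m ≤ j + j → m′ ≤ j + j → V m ≡ V m′ → m ≡ m′
    V-injective m m′ m≤2j m′≤2j eq = by-halves (m ≤? j) (m′ ≤? j)
      where
      high-height : ∀ i → j < i → i ≤ j + j → depth (B (j + j ∸ i)) + (j + j ∸ i) ≡ D
      high-height i j<i i≤2j = B-depth (j + j ∸ i) (≤-trans (<⇒≤ (mirror-< i j<i i≤2j)) j≤D)
      by-halves : Dec (m ≤ j) → Dec (m′ ≤ j) → m ≡ m′
      by-halves (yes m≤j) (yes m′≤j) = same-height (A m) (A-depth m (≤-trans m≤j j≤D))
        (subst (λ z → depth z + m′ ≡ D) (trans (sym (V-low m′ m′≤j)) (trans (sym eq) (V-low m m≤j)))
          (A-depth m′ (≤-trans m′≤j j≤D)))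
      by-halves (yes m≤j) (no m′≰j) =
        ⊥-elim (A≢B-across m m′ m≤j (≰⇒> m′≰j) m′≤2j (trans (sym (V-low m m≤j)) (trans eq (V-high m′ (<⇒≤ (≰⇒> m′≰j))))))
      by-halves (no m≰j) (yes m′≤j) =
        ⊥-elim (A≢B-across m′ m m′≤j (≰⇒> m≰j) m≤2j (trans (sym (V-low m′ m′≤j)) (trans (sym eq) (V-high m (<⇒≤ (≰⇒> m≰j))))))
      by-halves (no m≰j) (no m′≰j) = ∸-cancelˡ-≡ m≤2j m′≤2j (same-height (B (j + j ∸ m)) (high-height m (≰⇒> m≰j) m≤2j)
        (subst (λ z → depth z + (j + j ∸ m′) ≡ D)
          (trans (sym (V-high m′ (<⇒≤ (≰⇒> m′≰j)))) (trans (sym eq) (V-high m (<⇒≤ (≰⇒> m≰j)))))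
          (high-height m′ (≰⇒> m′≰j) m′≤2j)))

    climbing-nonroot : ∀ x i → i < D → depth x + i ≡ D → x ≢ r
    climbing-nonroot x i i<D h = nonroot x (+-cancelʳ-≤ i 1 (depth x) (≤-trans i<D (≤-reflexive (sym h))))

    parent-edge : ∀ x → x ≢ r → Adj G x (parent x) ≡ true
    parent-edge x x≢r = trans (SimpleGraph.sym G x (parent x)) (proj₁ (parent-spec x x≢r))

    V-step : ∀ m → suc m ≤ j + j → Adj G (V m) (V (suc m)) ≡ true
    V-step m 1+m≤2j = by-cases (suc m ≤? j)
      where
      by-cases : Dec (suc m ≤ j) → Adj G (V m) (V (suc m)) ≡ true
      by-cases (yes 1+m≤j) = subst₂ (λ u w → Adj G u w ≡ true)
        (sym (V-low m (≤-trans (n≤1+n m) 1+m≤j))) (sym (V-low (suc m) 1+m≤j))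
        (parent-edge (A m) (climbing-nonroot (A m) m (≤-trans 1+m≤j j≤D) (A-depth m (≤-trans (n≤1+n m) (≤-trans 1+m≤j j≤D)))))
      by-cases (no 1+m≰j) = subst₂ (λ u w → Adj G u w ≡ true)
        (sym (trans (V-high m (s≤s⁻¹ (≰⇒> 1+m≰j))) (cong B (mirror-suc (j + j) m 1+m≤2j))))
        (sym (V-high (suc m) (<⇒≤ (≰⇒> 1+m≰j))))
        (trans (SimpleGraph.sym G _ _) (parent-edge (B k′) (climbing-nonroot (B k′) k′ (≤-trans k′<j j≤D) (B-depth k′ (≤-trans (<⇒≤ k′<j) j≤D)))))
        where
        k′ : ℕ
        k′ = j + j ∸ suc m
        k′<j : k′ < j
        k′<j = mirror-< (suc m) (≰⇒> 1+m≰j) 1+m≤2j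

    V-start : V 0 ≡ a
    V-start = V-low 0 z≤n

    V-end : V (j + j) ≡ b
    V-end = trans (V-high (j + j) (m≤m+n j j)) (cong B (n∸n≡0 (j + j)))

    V-depth : ∀ m → m ≤ j + j → depth (V m) ≤ D
    V-depth m m≤2j = by-cases (m ≤? j)
      where
      by-cases : Dec (m ≤ j) → depth (V m) ≤ D
      by-cases (yes m≤j) = subst (_≤ D) (cong depth (sym (V-low m m≤j)))
        (≤-trans (m≤m+n _ m) (≤-reflexive (A-depth m (≤-trans m≤j j≤D))))
      by-cases (no m≰j) = subst (_≤ D) (cong depth (sym (V-high m (<⇒≤ (≰⇒> m≰j)))))
        (≤-trans (m≤m+n _ _) (≤-reflexive (B-depth (j + j ∸ m) (≤-trans (<⇒≤ (mirror-< m (≰⇒> m≰j) m≤2j)) j≤D))))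

    k : ℕ
    k = pred j + pred j

    j+j≡2+k : j + j ≡ 2 + k
    j+j≡2+k = double-pos j 0<j
      where
      double-pos : ∀ i → 0 < i → i + i ≡ 2 + (pred i + pred i)
      double-pos (suc i) _ = cong suc (+-suc i i)

    within : ∀ m → m < 3 + k → m ≤ j + j
    within m m<3+k = subst (m ≤_) (sym j+j≡2+k) (s≤s⁻¹ m<3+k)

    cycle-through-edge : Adj G b a ≡ true → Cycle G
    cycle-through-edge b~a = closed-path⇒cycle k V
      (λ m m′ m< m′< → V-injective m m′ (within m m<) (within m′ m′<))
      (λ m 1+m< → V-step m (within (suc m) 1+m<))
      (subst (λ i → Adj G (V i) (V 0) ≡ true) j+j≡2+k (subst₂ (λ u w → Adj G u w ≡ true) (sym V-end) (sym V-start) b~a))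

    cycle-through-child : ∀ x → depth x ≡ suc D → Adj G a x ≡ true → Adj G b x ≡ true → Cycle G
    cycle-through-child x dx a~x b~x = closed-path⇒cycle (suc k) c injective step
      (subst (λ w → Adj G w x ≡ true) (sym (trans (cong V (sym j+j≡2+k)) V-end)) b~x)
      where
      c : ℕ → Fin n
      c zero    = x
      c (suc m) = V m
      x≢V : ∀ m → m ≤ j + j → x ≢ V m
      x≢V m m≤2j x≡Vm = 1+n≰n (≤-trans (≤-reflexive (sym dx)) (subst (λ z → depth z ≤ D) (sym x≡Vm) (V-depth m m≤2j)))
      injective : ∀ m m′ → m < 3 + suc k → m′ < 3 + suc k → c m ≡ c m′ → m ≡ m′
      injective zero    zero     _  _   _  = refl
      injective zero    (suc m′) _  m′< eq = ⊥-elim (x≢V m′ (within m′ (s≤s⁻¹ m′<)) eq)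
      injective (suc m) zero     m< _   eq = ⊥-elim (x≢V m (within m (s≤s⁻¹ m<)) (sym eq))
      injective (suc m) (suc m′) m< m′< eq = cong suc (V-injective m m′ (within m (s≤s⁻¹ m<)) (within m′ (s≤s⁻¹ m′<)) eq)
      step : ∀ m → suc m < 3 + suc k → Adj G (c m) (c (suc m)) ≡ true
      step zero    _    = subst (λ w → Adj G x w ≡ true) (sym V-start) (trans (SimpleGraph.sym G x a) a~x)
      step (suc m) 2+m< = V-step m (within (suc m) (s≤s⁻¹ 2+m<))

  loopless : ∀ {a b} → Adj G a b ≡ true → a ≢ b
  loopless {a} a~b refl with trans (sym a~b) (SimpleGraph.irrefl G a)
  ... | ()

  adjacent-depths-differ : ∀ a b → Adj G a b ≡ true → depth a ≢ depth b
  adjacent-depths-differ a b a~b same =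
    acyclic (Meeting.cycle-through-edge a b (loopless a~b) same (trans (SimpleGraph.sym G b a) a~b))

  parent-unique : ∀ a b x → Adj G a x ≡ true → Adj G b x ≡ true → depth a ≡ depth b → depth x ≡ suc (depth a) → a ≡ b
  parent-unique a b x a~x b~x same dx with a Fin.≟ b
  ... | yes a≡b = a≡b
  ... | no a≢b  = ⊥-elim (acyclic (Meeting.cycle-through-child a b a≢b same x dx a~x b~x))

  deeper-end-is-child : ∀ a b → Adj G a b ≡ true → depth b ≡ suc (depth a) → b ≢ r × parent b ≡ a
  deeper-end-is-child a b a~b db = b≢r , parent-unique (parent b) a b (proj₁ spec) a~b
    (suc-injective (trans (proj₂ spec) db)) (sym (proj₂ spec))
    where
    b≢r : b ≢ r
    b≢r = nonroot b (subst (0 <_) (sym db) (s≤s z≤n))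
    spec : Adj G (parent b) b ≡ true × suc (depth (parent b)) ≡ depth b
    spec = parent-spec b b≢r

  edge-parent : ∀ a b → Adj G a b ≡ true → (b ≢ r × parent b ≡ a) ⊎ (a ≢ r × parent a ≡ b)
  edge-parent a b a~b with <-cmp (depth a) (depth b)
  ... | tri< da<db _ _ = inj₁ (deeper-end-is-child a b a~b (≤-antisym (depth-edge a b a~b) da<db))
  ... | tri≈ _ same _  = ⊥-elim (adjacent-depths-differ a b a~b same)
  ... | tri> _ _ db<da = inj₂ (deeper-end-is-child b a b~a (≤-antisym (depth-edge b a b~a) db<da))
    where
    b~a : Adj G b a ≡ true
    b~a = trans (SimpleGraph.sym G b a) a~b

  path-of : ℕ → Fin n → List (Fin n)
  path-of zero    x = []
  path-of (suc k) x = path-of k (parent x) ∷ʳ x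

  rooted : Rooted G
  rooted = record
    { root        = r
    ; parent      = parent
    ; path        = λ x → path-of (depth x) x
    ; path-root   = cong (λ k → path-of k r) depth-root
    ; path-parent = λ x x≢r → cong (λ k → path-of k x) (sym (proj₂ (parent-spec x x≢r)))
    ; parent-adj  = λ x x≢r → proj₁ (parent-spec x x≢r)
    ; edge-parent = edge-parent
    }

tree⇒rooted : ∀ {n} {G : SimpleGraph n} → IsTree G → Rooted G
tree⇒rooted {G = G} (1≤n , connected , acyclic) = BreadthFirst.rooted G connected acyclic (fromℕ< 1≤n)

module BowtieEmbedding {n} {G : SimpleGraph n} (R : Rooted G) where

  open import Data.Bool.Base using (Bool; false)
  open import Data.Empty using (⊥-elim)
  open import Data.Fin.Base using (splitAt; join)
  import Data.Fin.Properties as Fin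
  open import Data.List.Properties using (∷ʳ-injectiveʳ)
  open import Data.Nat.Base using (_+_)
  open import Data.Product.Base using (proj₁; proj₂)
  open import Data.Sum.Base using (inj₁; inj₂; [_,_]′)
  open import Function.Base using (id)
  open import Relation.Binary.PropositionalEquality hiding ([_])
  open import Relation.Nullary.Decidable.Core using (Dec; yes; no)
  open Rooted R
  open DoubledTree n using (Vertex; edge; Linked; TreeEmbedding)
  open Snoc using (∷ʳ≢[])

  path-injective : ∀ x y → path x ≡ path y → x ≡ y
  path-injective x y eq = by-cases (x Fin.≟ root) (y Fin.≟ root)
    where
    by-cases : Dec (x ≡ root) → Dec (y ≡ root) → x ≡ y
    by-cases (yes x≡r) (yes y≡r) = trans x≡r (sym y≡r)
    by-cases (yes x≡r) (no y≢r)  = ⊥-elim (∷ʳ≢[] _ y (trans (sym (path-parent y y≢r)) (trans (sym eq) (trans (cong path x≡r) path-root))))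
    by-cases (no x≢r)  (yes y≡r) = ⊥-elim (∷ʳ≢[] _ x (trans (sym (path-parent x x≢r)) (trans eq (trans (cong path y≡r) path-root))))
    by-cases (no x≢r)  (no y≢r)  = ∷ʳ-injectiveʳ _ _ (trans (sym (path-parent x x≢r)) (trans eq (path-parent y y≢r)))

  side : Fin (n + n) → Bool
  side x = [ (λ _ → true) , (λ _ → false) ]′ (splitAt n x)

  copy-injective : ∀ x y → strip x ≡ strip y → side x ≡ side y → x ≡ y
  copy-injective x y same-strip same-side =
    trans (sym (Fin.join-splitAt n n x)) (trans (cong (join n n) (halves (splitAt n x) (splitAt n y) same-strip same-side)) (Fin.join-splitAt n n y))
    where
    halves : ∀ (u v : Fin n ⊎ Fin n) → [ id , id ]′ u ≡ [ id , id ]′ v →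
             [ (λ _ → true) , (λ _ → false) ]′ u ≡ [ (λ _ → true) , (λ _ → false) ]′ v → u ≡ v
    halves (inj₁ i) (inj₁ i′) i≡i′ _ = cong inj₁ i≡i′
    halves (inj₂ i) (inj₂ i′) i≡i′ _ = cong inj₂ i≡i′
    halves (inj₁ _) (inj₂ _)  _ ()
    halves (inj₂ _) (inj₁ _)  _ ()

  node : Fin (n + n) → Vertex
  node x = path (strip x) , side x

  node-linked : ∀ x y → Adj G (strip x) (strip y) ≡ true → Linked (node x) (node y)
  node-linked x y adj with edge-parent (strip x) (strip y) adj
  ... | inj₁ (y≢r , py≡x) = edge (path (strip x)) (side x) (strip y) (side y) ,
    inj₁ (refl , cong (_, side y) (trans (path-parent (strip y) y≢r) (cong (λ z → path z ∷ʳ strip y) py≡x)))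
  ... | inj₂ (x≢r , px≡y) = edge (path (strip y)) (side y) (strip x) (side x) ,
    inj₂ (cong (_, side x) (trans (path-parent (strip x) x≢r) (cong (λ z → path z ∷ʳ strip x) px≡y)) , refl)

  bowtie-embedding : TreeEmbedding (bowtie G)
  bowtie-embedding = record
    { node           = node
    ; node-injective = λ x y eq → copy-injective x y (path-injective (strip x) (strip y) (cong proj₁ eq)) (cong proj₂ eq)
    ; node-linked    = node-linked
    }

module Counting where

  open import Data.Nat.Properties
  open import Algebra.Properties.CommutativeMonoid.Sum +-0-commutativeMonoid
    using (sum; sum-cong-≗; ∑-distrib-+; ∑-comm; sum-replicate-zero)
  open import Data.Bool.Base using (Bool; false; if_then_else_; _∧_)
  open import Data.Empty using (⊥; ⊥-elim)
  open import Data.Fin.Base using (toℕ; _↑ˡ_; _↑ʳ_) renaming (zero to fzero; suc to fsuc)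
  import Data.Fin.Properties as Fin
  open import Data.List.Base as List using (allFin)
  import Data.List.Properties as List
  import Data.Nat.ListAction as ListAction
  open import Data.Nat.Base
  open import Data.Sum.Base using ([_,_]′)
  open import Data.Nat.Tactic.RingSolver using (solve-∀)
  open import Function.Base using (_∘_; id)
  open import Relation.Binary.Definitions using (tri<; tri≈; tri>)
  open import Relation.Binary.PropositionalEquality
  open import Relation.Nullary.Decidable.Core using (does)
  open import Relation.Nullary.Negation.Core using (¬_)

  ⟦_⟧ : Bool → ℕ
  ⟦ b ⟧ = if b then 1 else 0

  sum-map-allFin : ∀ {m} (f : Fin m → ℕ) → ListAction.sum (List.map f (allFin m)) ≡ sum f
  sum-map-allFin {m} f = trans (cong ListAction.sum (List.map-tabulate id f)) (sum-tabulate f)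
    where
    sum-tabulate : ∀ {m} (f : Fin m → ℕ) → ListAction.sum (List.tabulate f) ≡ sum f
    sum-tabulate {zero}  f = refl
    sum-tabulate {suc m} f = cong (f fzero +_) (sum-tabulate (f ∘ fsuc))

  sum-const-1 : ∀ m → sum {m} (λ _ → 1) ≡ m
  sum-const-1 zero    = refl
  sum-const-1 (suc m) = cong suc (sum-const-1 m)

  sum-indicator : ∀ {m} (z : Fin m) → sum (λ y → ⟦ does (y Fin.≟ z) ⟧) ≡ 1
  sum-indicator {suc m} fzero    = cong suc (sum-replicate-zero m)
  sum-indicator {suc m} (fsuc z) = sum-indicator z

  sum-↑ : ∀ m k (f : Fin (m + k) → ℕ) → sum f ≡ sum (f ∘ (_↑ˡ k)) + sum (f ∘ (m ↑ʳ_))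
  sum-↑ zero    k f = refl
  sum-↑ (suc m) k f = trans (cong (f fzero +_) (sum-↑ m k (f ∘ fsuc))) (sym (+-assoc (f fzero) _ _))

  sum-strip : ∀ m (g : Fin m → ℕ) → sum {m + m} (g ∘ strip) ≡ sum g + sum g
  sum-strip m g = trans (sum-↑ m m (g ∘ strip)) (cong₂ _+_
    (sum-cong-≗ (λ i → cong (λ u → g ([ id , id ]′ u)) (Fin.splitAt-↑ˡ m i m)))
    (sum-cong-≗ (λ i → cong (λ u → g ([ id , id ]′ u)) (Fin.splitAt-↑ʳ m m i))))

  degree-sum : ∀ {m} → SimpleGraph m → ℕ
  degree-sum {m} H = sum λ i → sum λ j → ⟦ Adj H i j ⟧

  <ᵇ-true : ∀ {a b} → a < b → (a <ᵇ b) ≡ true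
  <ᵇ-true {a} {b} a<b with a <ᵇ b | <⇒<ᵇ a<b
  ... | true | _ = refl

  <ᵇ-false : ∀ {a b} → ¬ a < b → (a <ᵇ b) ≡ false
  <ᵇ-false {a} {b} a≮b with a <ᵇ b | <ᵇ⇒< a b
  ... | false | _    = refl
  ... | true  | a<b = ⊥-elim (a≮b (a<b _))

  handshake : ∀ {m} (H : SimpleGraph m) → degree-sum H ≡ edgeCount H + edgeCount H
  handshake {m} H = begin
    degree-sum H                                                ≡⟨ sum-cong-≗ (λ i → trans (sum-cong-≗ (split i)) (∑-distrib-+ (U i) (λ j → U j i))) ⟩
    sum (λ i → sum (U i) + sum (λ j → U j i))                    ≡⟨ ∑-distrib-+ (λ i → sum (U i)) (λ i → sum (λ j → U j i)) ⟩
    sum (λ i → sum (U i)) + sum (λ i → sum (λ j → U j i))        ≡⟨ cong (sum (λ i → sum (U i)) +_) (∑-comm U) ⟨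
    sum (λ i → sum (U i)) + sum (λ i → sum (U i))                ≡⟨ cong₂ _+_ edgeCount≡ edgeCount≡ ⟩
    edgeCount H + edgeCount H                                    ∎
    where
    open ≡-Reasoning
    U : Fin m → Fin m → ℕ
    U i j = if (toℕ i <ᵇ toℕ j) ∧ Adj H i j then 1 else 0
    split : ∀ i j → ⟦ Adj H i j ⟧ ≡ U i j + U j i
    split i j with <-cmp (toℕ i) (toℕ j)
    ... | tri< i<j _ j≮i rewrite <ᵇ-true i<j | <ᵇ-false j≮i = sym (+-identityʳ _)
    ... | tri> i≮j _ j<i rewrite <ᵇ-true j<i | <ᵇ-false i≮j | SimpleGraph.sym H j i = refl
    ... | tri≈ _ i≡j _  rewrite Fin.toℕ-injective i≡j | <ᵇ-false (n≮n (toℕ j)) | SimpleGraph.irrefl H j = refl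
    edgeCount≡ : sum (λ i → sum (U i)) ≡ edgeCount H
    edgeCount≡ = sym (trans (sum-map-allFin (λ i → ListAction.sum (List.map (U i) (allFin m)))) (sum-cong-≗ (λ i → sum-map-allFin (U i))))

  bowtie-degree-sum : ∀ {n} (G : SimpleGraph n) → degree-sum (bowtie G) ≡ (degree-sum G + degree-sum G) + (degree-sum G + degree-sum G)
  bowtie-degree-sum {n} G = trans (sum-cong-≗ (λ x → sum-strip n (λ j → ⟦ Adj G (strip x) j ⟧)))
    (trans (sum-strip n (λ i → row i + row i)) (cong₂ _+_ (∑-distrib-+ row row) (∑-distrib-+ row row)))
    where
    row : Fin n → ℕ
    row i = sum (λ j → ⟦ Adj G i j ⟧)

  module TreeDegrees {n} {G : SimpleGraph n} (R : Rooted G) where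

    open Rooted R
    open Snoc using (length-∷ʳ)
    open import Data.List.Base using (length)
    open import Data.Sum.Base using (inj₁; inj₂)
    open import Relation.Nullary.Decidable using (Dec; yes; no; dec-true; dec-false)

    up-of : ∀ x → Dec (x ≡ root) → Fin n → ℕ
    up-of x (yes _) y = 0
    up-of x (no _)  y = ⟦ does (y Fin.≟ parent x) ⟧

    up : Fin n → Fin n → ℕ
    up x = up-of x (x Fin.≟ root)

    up-sum : ∀ x → sum (up x) + ⟦ does (x Fin.≟ root) ⟧ ≡ 1
    up-sum x = by-cases (x Fin.≟ root)
      where
      by-cases : (x≟r : Dec (x ≡ root)) → sum (up-of x x≟r) + ⟦ does x≟r ⟧ ≡ 1
      by-cases (yes _) = cong (_+ 1) (sum-replicate-zero n)
      by-cases (no _)  = trans (+-identityʳ _) (sum-indicator (parent x))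

    up≡1 : ∀ x y → x ≢ root → parent x ≡ y → up x y ≡ 1
    up≡1 x y x≢r px≡y = by-cases (x Fin.≟ root)
      where
      by-cases : (x≟r : Dec (x ≡ root)) → up-of x x≟r y ≡ 1
      by-cases (yes x≡r) = ⊥-elim (x≢r x≡r)
      by-cases (no _)    = cong ⟦_⟧ (dec-true (y Fin.≟ parent x) (sym px≡y))

    up≡0 : ∀ x y → ¬ (x ≢ root × parent x ≡ y) → up x y ≡ 0
    up≡0 x y ¬up = by-cases (x Fin.≟ root)
      where
      by-cases : (x≟r : Dec (x ≡ root)) → up-of x x≟r y ≡ 0
      by-cases (yes _)   = refl
      by-cases (no x≢r) = cong ⟦_⟧ (dec-false (y Fin.≟ parent x) (λ y≡px → ¬up (x≢r , sym y≡px)))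

    no-2-cycle : ∀ x y → x ≢ root → parent x ≡ y → y ≢ root → parent y ≡ x → ⊥
    no-2-cycle x y x≢r px≡y y≢r py≡x = 1+n≰n (≤-trans (n≤1+n _) (≤-reflexive (sym (trans (depth≡ x y x≢r px≡y) (cong suc (depth≡ y x y≢r py≡x))))))
      where
      depth≡ : ∀ u v → u ≢ root → parent u ≡ v → length (path u) ≡ suc (length (path v))
      depth≡ u v u≢r pu≡v = trans (cong length (path-parent u u≢r)) (trans (length-∷ʳ (path (parent u)) u) (cong (suc ∘ length ∘ path) pu≡v))

    adjacency-by-parents : ∀ x y → ⟦ Adj G x y ⟧ ≡ up x y + up y x
    adjacency-by-parents x y with Adj G x y in x~y
    ... | false = sym (cong₂ _+_ (up≡0 x y (λ (x≢r , px≡y) → not-adjacent (subst (λ z → Adj G z x ≡ true) px≡y (parent-adj x x≢r)) (SimpleGraph.sym G x y)))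
                                 (up≡0 y x (λ (y≢r , py≡x) → not-adjacent (subst (λ z → Adj G z y ≡ true) py≡x (parent-adj y y≢r)) refl)))
      where
      not-adjacent : ∀ {u v} → Adj G u v ≡ true → Adj G x y ≡ Adj G u v → ⊥
      not-adjacent u~v xy≡uv with trans (sym x~y) (trans xy≡uv u~v)
      ... | ()
    ... | true with edge-parent x y x~y
    ...   | inj₁ (y≢r , py≡x) = sym (cong₂ _+_ (up≡0 x y (λ (x≢r , px≡y) → no-2-cycle x y x≢r px≡y y≢r py≡x)) (up≡1 y x y≢r py≡x))
    ...   | inj₂ (x≢r , px≡y) = sym (cong₂ _+_ (up≡1 x y x≢r px≡y) (up≡0 y x (λ (y≢r , py≡x) → no-2-cycle x y x≢r px≡y y≢r py≡x)))

    climbs : ℕ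
    climbs = sum λ x → sum (up x)

    climbs≡n-1 : climbs ≡ n ∸ 1
    climbs≡n-1 = begin
      climbs                                                      ≡⟨ m+n∸n≡m climbs 1 ⟨
      climbs + 1 ∸ 1                                              ≡⟨ cong (λ k → climbs + k ∸ 1) (sum-indicator root) ⟨
      climbs + sum (λ x → ⟦ does (x Fin.≟ root) ⟧) ∸ 1            ≡⟨ cong (_∸ 1) (∑-distrib-+ (λ x → sum (up x)) (λ x → ⟦ does (x Fin.≟ root) ⟧)) ⟨
      sum (λ x → sum (up x) + ⟦ does (x Fin.≟ root) ⟧) ∸ 1        ≡⟨ cong (_∸ 1) (trans (sum-cong-≗ up-sum) (sum-const-1 n)) ⟩
      n ∸ 1                                                       ∎
      where open ≡-Reasoning

    tree-degree-sum : degree-sum G ≡ (n ∸ 1) + (n ∸ 1)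
    tree-degree-sum = begin
      degree-sum G                                               ≡⟨ sum-cong-≗ (λ x → trans (sum-cong-≗ (adjacency-by-parents x)) (∑-distrib-+ (up x) (λ y → up y x))) ⟩
      sum (λ x → sum (up x) + sum (λ y → up y x))                ≡⟨ ∑-distrib-+ (λ x → sum (up x)) (λ x → sum (λ y → up y x)) ⟩
      climbs + sum (λ x → sum (λ y → up y x))                    ≡⟨ cong (climbs +_) (∑-comm up) ⟨
      climbs + climbs                                            ≡⟨ cong₂ _+_ climbs≡n-1 climbs≡n-1 ⟩
      (n ∸ 1) + (n ∸ 1)                                          ∎
      where open ≡-Reasoning

  double-injective : ∀ a b → a + a ≡ b + b → a ≡ b
  double-injective a b a+a≡b+b = *-cancelˡ-≡ a b 2
    (trans (cong (a +_) (+-identityʳ a)) (trans a+a≡b+b (sym (cong (b +_) (+-identityʳ b)))))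

  tree-bowtie-edgeCount : ∀ {n} {G : SimpleGraph n} → Rooted G → edgeCount (bowtie G) ≡ 2 * (2 * n ∸ 2)
  tree-bowtie-edgeCount {n} {G} R = double-injective _ _ (begin
    edgeCount (bowtie G) + edgeCount (bowtie G)      ≡⟨ handshake (bowtie G) ⟨
    degree-sum (bowtie G)                            ≡⟨ bowtie-degree-sum G ⟩
    (degree-sum G + degree-sum G) + (degree-sum G + degree-sum G)
                                                     ≡⟨ cong (λ s → (s + s) + (s + s)) (TreeDegrees.tree-degree-sum R) ⟩
    (k + k + (k + k)) + (k + k + (k + k))            ≡⟨ cong₂ _+_ (quadruple k) (quadruple k) ⟩
    2 * (2 * k) + 2 * (2 * k)                         ≡⟨ cong (λ m → 2 * m + 2 * m) (*-distribˡ-∸ 2 n 1) ⟩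
    2 * (2 * n ∸ 2) + 2 * (2 * n ∸ 2)                 ∎)
    where
    open ≡-Reasoning
    k : ℕ
    k = n ∸ 1
    quadruple : ∀ k → k + k + (k + k) ≡ 2 * (2 * k)
    quadruple = solve-∀

open import Data.Nat.Base using (_*_; _∸_)

lemma1 : ∀ (n : ℕ) (G : SimpleGraph n) → IsTree G →
    Bipartite (bowtie G) × Planar (bowtie G) × (edgeCount (bowtie G) ≡ 2 * (2 * n ∸ 2))
lemma1 n G tree = embedding⇒bipartite embedding , embedding⇒planar embedding , Counting.tree-bowtie-edgeCount rooted
  where
  open DoubledTree n using (TreeEmbedding; embedding⇒bipartite; embedding⇒planar)
  rooted : Rooted G
  rooted = tree⇒rooted tree
  embedding : TreeEmbedding (bowtie G)
  embedding = BowtieEmbedding.bowtie-embedding rooted
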